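{- Let $p\ge 2$, $n\ge 2$, let $E(X)=X^n+a_{n-1}X^{n-1}+\dots+a_0\in\mathbb{Z}[X]$ be irreducible, let $\gamma$ be an integer with $E(\gamma)\equiv0\pmod p$, and let $\mathfrak{L}\subseteq\mathbb{Z}^n$ be the lattice generated by the rows $A_0=(p,0,\dots,0)$ and $A_i=-\gamma e_{i-1}+e_i$ ($1\le i\le n-1$). Let $\mathbf{C}$ be the companion matrix of $E$ (entries $\mathbf{C}_{i,i+1}=1$ for $0\le i\le n-2$, last row $(-a_0,\dots,-a_{n-1})$, others $0$). Let $V$ be a nonzero vector of $\mathfrak{L}$. Then the vectors $B_i=V\mathbf{C}^i$, $0\le i\le n-1$, form a basis of a sublattice $\mathfrak{L}'\subseteq\mathfrak{L}$ of rank $n$, and $V\in\mathfrak{L}'$.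
   Context: A vector $V=(v_0,\dots,v_{n-1})$ is identified with $V(X)=\sum v_iX^i$; $V\mathbf{C}^i$ is the coefficient vector of $X^iV(X)\bmod E(X)$. $e_0,\dots,e_{n-1}$ is the standard basis of $\mathbb{Z}^n$. -}

module Defs where

open import Data.Nat as ℕ using (ℕ; zero; suc)
open import Data.Integer using (ℤ; +_; -_; _+_; _*_; _-_)
open import Data.Fin using (Fin; toℕ)
import Data.Fin as Fin
open import Data.List using (List; []; _∷_; _++_)
open import Data.Vec using (tabulate; toList)
open import Data.Product using (Σ; ∃; _×_; _,_)
open import Data.Sum using (_⊎_)
open import Relation.Nullary using (¬_; yes; no)
open import Relation.Binary.PropositionalEquality using (_≡_)

-- Polynomials in ℤ[X] as coefficient lists (lowest degree first).

Poly : Set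
Poly = List ℤ

coeff : Poly → ℕ → ℤ
coeff []       _       = + 0
coeff (c ∷ _)  zero    = c
coeff (_ ∷ cs) (suc k) = coeff cs k

scale : ℤ → Poly → Poly
scale c []       = []
scale c (d ∷ ds) = c * d ∷ scale c ds

addP : Poly → Poly → Poly
addP []       q        = q
addP p        []       = p
addP (c ∷ cs) (d ∷ ds) = (c + d) ∷ addP cs ds

mulP : Poly → Poly → Poly
mulP []       q = []
mulP (c ∷ cs) q = addP (scale c q) (+ 0 ∷ mulP cs q)

_≈P_ : Poly → Poly → Set
P ≈P Q = ∀ k → coeff P k ≡ coeff Q k

IsUnitP : Poly → Set
IsUnitP P = (P ≈P (+ 1 ∷ [])) ⊎ (P ≈P (- (+ 1) ∷ []))

IrreducibleP : Poly → Set
IrreducibleP P = ¬ (P ≈P []) × ¬ IsUnitP P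
               × (∀ F G → P ≈P mulP F G → IsUnitP F ⊎ IsUnitP G)

evalP : Poly → ℤ → ℤ
evalP []       x = + 0
evalP (c ∷ cs) x = c + x * evalP cs x

monicPoly : (n : ℕ) → (Fin n → ℤ) → Poly
monicPoly n a = toList (tabulate a) ++ (+ 1 ∷ [])

Vecℤ : ℕ → Set
Vecℤ n = Fin n → ℤ

sumF : ∀ {n} → (Fin n → ℤ) → ℤ
sumF {zero}  f = + 0
sumF {suc n} f = f Fin.zero + sumF (λ i → f (Fin.suc i))

InSpan : ∀ {m n} → (Fin m → Vecℤ n) → Vecℤ n → Set
InSpan {m} R w = Σ (Fin m → ℤ) λ c → ∀ j → w j ≡ sumF (λ i → c i * R i j)

LinIndep : ∀ {m n} → (Fin m → Vecℤ n) → Set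
LinIndep {m} R = ∀ (c : Fin m → ℤ) →
  (∀ j → sumF (λ i → c i * R i j) ≡ + 0) → ∀ i → c i ≡ + 0

IsZeroVec : ∀ {n} → Vecℤ n → Set
IsZeroVec v = ∀ j → v j ≡ + 0

δ : ℕ → ℕ → ℤ
δ k l with k ℕ.≟ l
... | yes _ = + 1
... | no  _ = + 0

genA : ∀ {n} → ℕ → ℤ → Fin n → Vecℤ n
genA p γ i j with toℕ i
... | zero  = (+ p) * δ (toℕ j) 0
... | suc k = (- γ) * δ (toℕ j) k + δ (toℕ j) (suc k)

companion : (n : ℕ) → (Fin n → ℤ) → Fin n → Fin n → ℤ
companion n a i j with suc (toℕ i) ℕ.≟ n
... | yes _ = - a j
... | no  _ = δ (toℕ j) (suc (toℕ i))

vecMat : ∀ {n} → Vecℤ n → (Fin n → Fin n → ℤ) → Vecℤ n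
vecMat v M j = sumF (λ i → v i * M i j)

vecMatPow : ∀ {n} → Vecℤ n → (Fin n → Fin n → ℤ) → ℕ → Vecℤ n
vecMatPow v M zero    = v
vecMatPow v M (suc k) = vecMat (vecMatPow v M k) M

-- Identify a vector of ℤⁿ with the polynomial of degree < n having it as coefficient list.
-- Multiplying by the companion matrix C is multiplication by X followed by reduction
-- modulo the monic E, so Σ cᵢ·VCⁱ ≡ c(X)·V(X) (mod E). The generators of 𝔏 are p and
-- Xⁱ(X − γ), so 𝔏 = {W : p ∣ W(γ)} (synthetic division by X − γ gives the converse);
-- since p ∣ E(γ), every c(X)V(X) + E(X)R(X) with V ∈ 𝔏 is again in 𝔏.
-- Independence: c(X)V(X) ≡ 0 (mod E) with c, V ≠ 0 of degree < n = deg E is impossible.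
-- Pseudo-dividing E by c leaves a remainder of lower degree with the same property, and a
-- zero remainder gives gᵏE = Q·c with both factors nonconstant; cancelling the primes of gᵏ
-- one by one by the Gauss lemma (a prime dividing Q·c divides Q or c) contradicts the
-- irreducibility of E.
module Submission where

open import Defs

open import Algebra.Bundles using (CommutativeRing)
open import Data.Empty using (⊥-elim)
open import Data.Fin using (Fin; toℕ; fromℕ<) renaming (zero to fzero; suc to fsuc)
open import Data.Fin.Permutation using (reverse; _⟨$⟩ʳ_)
import Data.Fin.Properties as Finₚ
open import Data.Integer as ℤ using (ℤ; +_; -_; _+_; _*_; _^_; 0ℤ; 1ℤ; -1ℤ; +0; +[1+_]; -[1+_])
open import Data.Integer.Divisibility using (_∣_)
open import Data.Integer.Divisibility.Signed
  using (divides; _∣?_; ∣ᵤ⇒∣; ∣⇒∣ᵤ; ∣m+n∣n⇒∣m; ∣m∣n⇒∣m+n; ∣m⇒∣m*n; ∣n⇒∣m*n) renaming (_∣_ to _∣ₛ_)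
open import Data.Integer.Properties
open import Data.Integer.Tactic.RingSolver using (solve-∀)
open import Data.List using ([]; _∷_; [_]; length)
open import Data.List.Relation.Unary.All using () renaming (_∷_ to _∷ᴬ_)
open import Data.Nat as ℕ using (ℕ; zero; suc; _∸_; _≤_; _<_; z≤n; s≤s)
import Data.Nat.Divisibility as ℕᵈ
open import Data.Nat.Induction using (<-rec)
open import Data.Nat.ListAction using (product)
open import Data.Nat.Primality using (Prime; euclidsLemma; prime⇒nonZero; prime⇒nonTrivial)
open import Data.Nat.Primality.Factorisation using (factorise)
import Data.Nat.Properties as ℕₚ
open import Data.Product using (Σ; _×_; _,_; proj₁; proj₂)
open import Data.Sum as Sum using (_⊎_; inj₁; inj₂)
open import Data.Vec using (tabulate; toList)
open import Data.Vec.Functional using (removeAt)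
open import Function using (_∘_)
open import Level using (0ℓ)
open import Relation.Binary.Bundles using (Setoid)
open import Relation.Binary.Definitions using (tri<; tri≈; tri>)
open import Relation.Binary.PropositionalEquality hiding ([_])
import Relation.Binary.Reasoning.Setoid as SetoidReasoning
open import Relation.Nullary using (¬_; Dec; yes; no)
open import Relation.Nullary.Decidable using (map′; dec⇒maybe)
open import Tactic.RingSolver.Core.AlmostCommutativeRing using (AlmostCommutativeRing; fromCommutativeRing)

open import Algebra.Properties.CommutativeMonoid.Sum +-0-commutativeMonoid
  using (sum; sum⁺-syntax; sum-cong-≗; sum-replicate-zero; sum-remove; ∑-distrib-+; ∑-permute)
open import Algebra.Properties.Semiring.Sum +-*-semiring using (*-distribˡ-sum)

sum-zero : ∀ {n} (f : Fin n → ℤ) → (∀ i → f i ≡ 0ℤ) → sum f ≡ 0ℤ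
sum-zero {n} f f≗0 = trans (sum-cong-≗ f≗0) (sum-replicate-zero n)

sum-single : ∀ {n} (f : Fin n → ℤ) i → (∀ j → j ≢ i → f j ≡ 0ℤ) → sum f ≡ f i
sum-single {suc n} f i others = begin
  sum f                    ≡⟨ sum-remove {i = i} f ⟩
  f i + sum (removeAt f i) ≡⟨ cong (_+_ (f i)) (sum-zero _ (λ j → others _ (Finₚ.punchInᵢ≢i i j))) ⟩
  f i + 0ℤ                 ≡⟨ +-identityʳ (f i) ⟩
  f i                      ∎
  where open ≡-Reasoning

∣-sum : ∀ {d n} (f : Fin n → ℤ) → (∀ i → d ∣ₛ f i) → d ∣ₛ sum f
∣-sum {n = zero}  f d∣f = divides 0ℤ refl
∣-sum {n = suc n} f d∣f = ∣m∣n⇒∣m+n (d∣f fzero) (∣-sum (f ∘ fsuc) (d∣f ∘ fsuc))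

∣-sum⇒∣-term : ∀ {d n} (f : Fin n → ℤ) i → d ∣ₛ sum f → (∀ j → j ≢ i → d ∣ₛ f j) → d ∣ₛ f i
∣-sum⇒∣-term {n = suc n} f i d∣∑ others =
  ∣m+n∣n⇒∣m (subst (_ ∣ₛ_) (sum-remove {i = i} f) d∣∑)
            (∣-sum (removeAt f i) (λ j → others _ (Finₚ.punchInᵢ≢i i j)))

coeff-addP : ∀ P Q k → coeff (addP P Q) k ≡ coeff P k + coeff Q k
coeff-addP []       Q        k       = sym (+-identityˡ _)
coeff-addP (c ∷ cs) []       k       = sym (+-identityʳ _)
coeff-addP (c ∷ cs) (d ∷ ds) zero    = refl
coeff-addP (c ∷ cs) (d ∷ ds) (suc k) = coeff-addP cs ds k

coeff-scale : ∀ c P k → coeff (scale c P) k ≡ c * coeff P k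
coeff-scale c []       k       = sym (*-zeroʳ c)
coeff-scale c (d ∷ ds) zero    = refl
coeff-scale c (d ∷ ds) (suc k) = coeff-scale c ds k

convolution : (ℕ → ℤ) → (ℕ → ℤ) → ℕ → ℤ
convolution f g k = ∑[ i ≤ k ] (f (toℕ i) * g (k ∸ toℕ i))

convolution-cong : ∀ {f f′ g g′ : ℕ → ℤ} → (∀ i → f i ≡ f′ i) → (∀ i → g i ≡ g′ i) →
                   ∀ k → convolution f g k ≡ convolution f′ g′ k
convolution-cong f≗f′ g≗g′ k = sum-cong-≗ {suc k} λ i → cong₂ _*_ (f≗f′ (toℕ i)) (g≗g′ (k ∸ toℕ i))

convolution-comm : ∀ (f g : ℕ → ℤ) k → convolution f g k ≡ convolution g f k
convolution-comm f g k = trans (∑-permute {suc k} (λ i → f (toℕ i) * g (k ∸ toℕ i)) reverse) (sum-cong-≗ {suc k} swap)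
  where
  swap : ∀ (i : Fin (suc k)) → f (toℕ (reverse ⟨$⟩ʳ i)) * g (k ∸ toℕ (reverse ⟨$⟩ʳ i)) ≡ g (toℕ i) * f (k ∸ toℕ i)
  swap i = trans (cong₂ (λ a b → f a * g b) opp (trans (cong (k ∸_) opp) (ℕₚ.m∸[m∸n]≡n (ℕₚ.≤-pred (Finₚ.toℕ<n i)))))
                 (*-comm (f (k ∸ toℕ i)) (g (toℕ i)))
    where opp : toℕ (reverse ⟨$⟩ʳ i) ≡ k ∸ toℕ i
          opp = Finₚ.opposite-prop i

convolution-distribʳ : ∀ (f f′ g : ℕ → ℤ) k →
  convolution (λ i → f i + f′ i) g k ≡ convolution f g k + convolution f′ g k
convolution-distribʳ f f′ g k = begin
  ∑[ i ≤ k ] ((f (toℕ i) + f′ (toℕ i)) * g (k ∸ toℕ i))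
    ≡⟨ sum-cong-≗ {suc k} (λ i → *-distribʳ-+ (g (k ∸ toℕ i)) (f (toℕ i)) (f′ (toℕ i))) ⟩
  ∑[ i ≤ k ] (f (toℕ i) * g (k ∸ toℕ i) + f′ (toℕ i) * g (k ∸ toℕ i))
    ≡⟨ ∑-distrib-+ {suc k} (λ i → f (toℕ i) * g (k ∸ toℕ i)) (λ i → f′ (toℕ i) * g (k ∸ toℕ i)) ⟩
  convolution f g k + convolution f′ g k
    ∎
  where open ≡-Reasoning

convolution-scaleˡ : ∀ c (f g : ℕ → ℤ) k → convolution (λ i → c * f i) g k ≡ c * convolution f g k
convolution-scaleˡ c f g k =
  trans (sum-cong-≗ {suc k} λ i → *-assoc c (f (toℕ i)) (g (k ∸ toℕ i))) (sym (*-distribˡ-sum {suc k} c (λ i → f (toℕ i) * g (k ∸ toℕ i))))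

off-diagonal : ∀ a b {t} → t ≤ a ℕ.+ b → t ≢ a →
               (t < a × b < a ℕ.+ b ∸ t) ⊎ (a < t × a ℕ.+ b ∸ t < b)
off-diagonal a b {t} t≤a+b t≢a with ℕₚ.<-cmp t a
... | tri< t<a _ _ = inj₁ (t<a , subst (_< a ℕ.+ b ∸ t) (ℕₚ.m+n∸m≡n a b) (ℕₚ.∸-monoʳ-< t<a (ℕₚ.m≤m+n a b)))
... | tri≈ _ t≡a _ = ⊥-elim (t≢a t≡a)
... | tri> _ _ a<t = inj₂ (a<t , subst (a ℕ.+ b ∸ t <_) (ℕₚ.m+n∸m≡n a b) (ℕₚ.∸-monoʳ-< a<t t≤a+b))

module _ (f g : ℕ → ℤ) (a b : ℕ) where

  private
    a↑ : Fin (suc (a ℕ.+ b))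
    a↑ = fromℕ< (s≤s (ℕₚ.m≤m+n a b))

    term-a↑ : f (toℕ a↑) * g (a ℕ.+ b ∸ toℕ a↑) ≡ f a * g b
    term-a↑ = trans (cong (λ t → f t * g (a ℕ.+ b ∸ t)) (Finₚ.toℕ-fromℕ< _)) (cong (λ t → f a * g t) (ℕₚ.m+n∸m≡n a b))

    ≢a↑ : ∀ j → j ≢ a↑ → toℕ j ≢ a
    ≢a↑ j j≢a↑ j≡a = j≢a↑ (Finₚ.toℕ-injective (trans j≡a (sym (Finₚ.toℕ-fromℕ< _))))

    ≤a+b : ∀ (j : Fin (suc (a ℕ.+ b))) → toℕ j ≤ a ℕ.+ b
    ≤a+b j = ℕₚ.≤-pred (Finₚ.toℕ<n j)

  convolution-top : (∀ i → a < i → f i ≡ 0ℤ) → (∀ j → b < j → g j ≡ 0ℤ) →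
                    convolution f g (a ℕ.+ b) ≡ f a * g b
  convolution-top f-top g-top = trans (sum-single _ a↑ others) term-a↑
    where
    others : ∀ j → j ≢ a↑ → f (toℕ j) * g (a ℕ.+ b ∸ toℕ j) ≡ 0ℤ
    others j j≢a↑ with off-diagonal a b (≤a+b j) (≢a↑ j j≢a↑)
    ... | inj₁ (_ , b<) = trans (cong (f (toℕ j) *_) (g-top _ b<)) (*-zeroʳ (f (toℕ j)))
    ... | inj₂ (a< , _) = trans (cong (_* g (a ℕ.+ b ∸ toℕ j)) (f-top _ a<)) (*-zeroˡ (g (a ℕ.+ b ∸ toℕ j)))

  ∣-convolution⇒∣-product : ∀ {d} → (∀ i → i < a → d ∣ₛ f i) → (∀ j → j < b → d ∣ₛ g j) →
                            d ∣ₛ convolution f g (a ℕ.+ b) → d ∣ₛ f a * g b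
  ∣-convolution⇒∣-product d∣f d∣g d∣conv = subst (_ ∣ₛ_) term-a↑ (∣-sum⇒∣-term _ a↑ d∣conv others)
    where
    others : ∀ j → j ≢ a↑ → _ ∣ₛ f (toℕ j) * g (a ℕ.+ b ∸ toℕ j)
    others j j≢a↑ with off-diagonal a b (≤a+b j) (≢a↑ j j≢a↑)
    ... | inj₁ (<a , _) = ∣m⇒∣m*n (g (a ℕ.+ b ∸ toℕ j)) (d∣f _ <a)
    ... | inj₂ (_ , <b) = ∣n⇒∣m*n (f (toℕ j)) (d∣g _ <b)

convolution-above : ∀ (f g : ℕ → ℤ) a b → (∀ i → a < i → f i ≡ 0ℤ) → (∀ j → b < j → g j ≡ 0ℤ) →
                    ∀ k → a ℕ.+ b < k → convolution f g k ≡ 0ℤ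
convolution-above f g a b f-top g-top k a+b<k = sum-zero {suc k} _ term
  where
  term : ∀ (i : Fin (suc k)) → f (toℕ i) * g (k ∸ toℕ i) ≡ 0ℤ
  term i with ℕₚ.≤-<-connex (toℕ i) a
  ... | inj₂ a<i = trans (cong (_* g (k ∸ toℕ i)) (f-top _ a<i)) (*-zeroˡ (g (k ∸ toℕ i)))
  ... | inj₁ i≤a = trans (cong (f (toℕ i) *_) (g-top _ b<k∸i)) (*-zeroʳ (f (toℕ i)))
    where
    b<k∸i : b < k ∸ toℕ i
    b<k∸i = ℕₚ.<-≤-trans (subst (b <_) (sym (ℕₚ.m+n∸m≡n a (suc b)))
              (ℕₚ.n<1+n b)) (ℕₚ.∸-mono (subst (_≤ k) (sym (ℕₚ.+-suc a b)) a+b<k) i≤a)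

coeff-mulP : ∀ P Q k → coeff (mulP P Q) k ≡ convolution (coeff P) (coeff Q) k
coeff-mulP []       Q k       = sym (sum-zero {suc k} _ (λ i → *-zeroˡ (coeff Q (k ∸ toℕ i))))
coeff-mulP (c ∷ cs) Q zero    = trans (coeff-addP (scale c Q) _ 0) (cong (_+ 0ℤ) (coeff-scale c Q 0))
coeff-mulP (c ∷ cs) Q (suc k) =
  trans (coeff-addP (scale c Q) _ (suc k)) (cong₂ _+_ (coeff-scale c Q (suc k)) (coeff-mulP cs Q k))

-- A record around _≈P_, so that both polynomials can be read off (and inferred from) the type.
record _≋_ (P Q : Poly) : Set where
  constructor mk≋
  field coeff-≡ : P ≈P Q
open _≋_ public
infix 4 _≋_

≡⇒≋ : ∀ {P Q} → P ≡ Q → P ≋ Q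
≡⇒≋ refl = mk≋ λ _ → refl

≋-refl : ∀ {P} → P ≋ P
≋-refl = mk≋ λ _ → refl

≋-sym : ∀ {P Q} → P ≋ Q → Q ≋ P
≋-sym (mk≋ e) = mk≋ (sym ∘ e)

≋-trans : ∀ {P Q R} → P ≋ Q → Q ≋ R → P ≋ R
≋-trans (mk≋ e) (mk≋ f) = mk≋ λ k → trans (e k) (f k)

negP : Poly → Poly
negP = scale -1ℤ

addP-cong : ∀ {P P′ Q Q′} → P ≋ P′ → Q ≋ Q′ → addP P Q ≋ addP P′ Q′
addP-cong {P} {P′} {Q} {Q′} (mk≋ e) (mk≋ f) = mk≋ λ k → begin
  coeff (addP P Q) k      ≡⟨ coeff-addP P Q k ⟩
  coeff P k + coeff Q k   ≡⟨ cong₂ _+_ (e k) (f k) ⟩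
  coeff P′ k + coeff Q′ k ≡⟨ coeff-addP P′ Q′ k ⟨
  coeff (addP P′ Q′) k    ∎
  where open ≡-Reasoning

scale-cong : ∀ c {P P′} → P ≋ P′ → scale c P ≋ scale c P′
scale-cong c {P} {P′} (mk≋ e) = mk≋ λ k → begin
  coeff (scale c P) k  ≡⟨ coeff-scale c P k ⟩
  c * coeff P k        ≡⟨ cong (c *_) (e k) ⟩
  c * coeff P′ k       ≡⟨ coeff-scale c P′ k ⟨
  coeff (scale c P′) k ∎
  where open ≡-Reasoning

mulP-cong : ∀ {P P′ Q Q′} → P ≋ P′ → Q ≋ Q′ → mulP P Q ≋ mulP P′ Q′
mulP-cong {P} {P′} {Q} {Q′} (mk≋ e) (mk≋ f) = mk≋ λ k → begin
  coeff (mulP P Q) k                      ≡⟨ coeff-mulP P Q k ⟩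
  convolution (coeff P) (coeff Q) k       ≡⟨ convolution-cong e f k ⟩
  convolution (coeff P′) (coeff Q′) k     ≡⟨ coeff-mulP P′ Q′ k ⟨
  coeff (mulP P′ Q′) k                    ∎
  where open ≡-Reasoning

addP-assoc : ∀ P Q R → addP (addP P Q) R ≋ addP P (addP Q R)
addP-assoc P Q R = mk≋ λ k → begin
  coeff (addP (addP P Q) R) k         ≡⟨ coeff-addP (addP P Q) R k ⟩
  coeff (addP P Q) k + coeff R k      ≡⟨ cong (_+ coeff R k) (coeff-addP P Q k) ⟩
  coeff P k + coeff Q k + coeff R k   ≡⟨ +-assoc (coeff P k) _ _ ⟩
  coeff P k + (coeff Q k + coeff R k) ≡⟨ cong (_+_ (coeff P k)) (coeff-addP Q R k) ⟨
  coeff P k + coeff (addP Q R) k      ≡⟨ coeff-addP P (addP Q R) k ⟨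
  coeff (addP P (addP Q R)) k         ∎
  where open ≡-Reasoning

addP-comm : ∀ P Q → addP P Q ≋ addP Q P
addP-comm P Q = mk≋ λ k → begin
  coeff (addP P Q) k    ≡⟨ coeff-addP P Q k ⟩
  coeff P k + coeff Q k ≡⟨ +-comm (coeff P k) _ ⟩
  coeff Q k + coeff P k ≡⟨ coeff-addP Q P k ⟨
  coeff (addP Q P) k    ∎
  where open ≡-Reasoning

addP-identityˡ : ∀ P → addP [] P ≋ P
addP-identityˡ P = ≋-refl

addP-identityʳ : ∀ P → addP P [] ≋ P
addP-identityʳ P = mk≋ λ k → trans (coeff-addP P [] k) (+-identityʳ _)

negP-inverseˡ : ∀ P → addP (negP P) P ≋ []
negP-inverseˡ P = mk≋ λ k → begin
  coeff (addP (negP P) P) k       ≡⟨ coeff-addP (negP P) P k ⟩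
  coeff (negP P) k + coeff P k    ≡⟨ cong (_+ coeff P k) (coeff-scale -1ℤ P k) ⟩
  -1ℤ * coeff P k + coeff P k     ≡⟨ cong (_+ coeff P k) (-1*i≡-i (coeff P k)) ⟩
  - coeff P k + coeff P k         ≡⟨ +-inverseˡ (coeff P k) ⟩
  0ℤ                              ∎
  where open ≡-Reasoning

negP-inverseʳ : ∀ P → addP P (negP P) ≋ []
negP-inverseʳ P = ≋-trans (addP-comm P (negP P)) (negP-inverseˡ P)

mulP-comm : ∀ P Q → mulP P Q ≋ mulP Q P
mulP-comm P Q = mk≋ λ k → begin
  coeff (mulP P Q) k                ≡⟨ coeff-mulP P Q k ⟩
  convolution (coeff P) (coeff Q) k ≡⟨ convolution-comm (coeff P) (coeff Q) k ⟩
  convolution (coeff Q) (coeff P) k ≡⟨ coeff-mulP Q P k ⟨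
  coeff (mulP Q P) k                ∎
  where open ≡-Reasoning

mulP-distribʳ : ∀ P P′ Q → mulP (addP P P′) Q ≋ addP (mulP P Q) (mulP P′ Q)
mulP-distribʳ P P′ Q = mk≋ λ k → begin
  coeff (mulP (addP P P′) Q) k
    ≡⟨ coeff-mulP (addP P P′) Q k ⟩
  convolution (coeff (addP P P′)) (coeff Q) k
    ≡⟨ convolution-cong {g = coeff Q} (coeff-addP P P′) (λ _ → refl) k ⟩
  convolution (λ i → coeff P i + coeff P′ i) (coeff Q) k
    ≡⟨ convolution-distribʳ (coeff P) (coeff P′) (coeff Q) k ⟩
  convolution (coeff P) (coeff Q) k + convolution (coeff P′) (coeff Q) k
    ≡⟨ cong₂ _+_ (coeff-mulP P Q k) (coeff-mulP P′ Q k) ⟨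
  coeff (mulP P Q) k + coeff (mulP P′ Q) k
    ≡⟨ coeff-addP (mulP P Q) (mulP P′ Q) k ⟨
  coeff (addP (mulP P Q) (mulP P′ Q)) k
    ∎
  where open ≡-Reasoning

mulP-distribˡ : ∀ Q P P′ → mulP Q (addP P P′) ≋ addP (mulP Q P) (mulP Q P′)
mulP-distribˡ Q P P′ = ≋-trans (mulP-comm Q (addP P P′))
  (≋-trans (mulP-distribʳ P P′ Q) (addP-cong (mulP-comm P Q) (mulP-comm P′ Q)))

mulP-scaleˡ : ∀ c P Q → mulP (scale c P) Q ≋ scale c (mulP P Q)
mulP-scaleˡ c P Q = mk≋ λ k → begin
  coeff (mulP (scale c P) Q) k               ≡⟨ coeff-mulP (scale c P) Q k ⟩
  convolution (coeff (scale c P)) (coeff Q) k ≡⟨ convolution-cong {g = coeff Q} (coeff-scale c P) (λ _ → refl) k ⟩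
  convolution (λ i → c * coeff P i) (coeff Q) k ≡⟨ convolution-scaleˡ c (coeff P) (coeff Q) k ⟩
  c * convolution (coeff P) (coeff Q) k       ≡⟨ cong (c *_) (coeff-mulP P Q k) ⟨
  c * coeff (mulP P Q) k                      ≡⟨ coeff-scale c (mulP P Q) k ⟨
  coeff (scale c (mulP P Q)) k                ∎
  where open ≡-Reasoning

∷-cong : ∀ c {P Q} → P ≋ Q → (c ∷ P) ≋ (c ∷ Q)
∷-cong c (mk≋ e) = mk≋ λ { zero → refl ; (suc k) → e k }

mulP-shiftˡ : ∀ P Q → mulP (0ℤ ∷ P) Q ≋ (0ℤ ∷ mulP P Q)
mulP-shiftˡ P Q = mk≋ λ k → begin
  coeff (addP (scale 0ℤ Q) (0ℤ ∷ mulP P Q)) k         ≡⟨ coeff-addP (scale 0ℤ Q) _ k ⟩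
  coeff (scale 0ℤ Q) k + coeff (0ℤ ∷ mulP P Q) k      ≡⟨ cong (_+ coeff (0ℤ ∷ mulP P Q) k) (coeff-scale 0ℤ Q k) ⟩
  0ℤ * coeff Q k + coeff (0ℤ ∷ mulP P Q) k            ≡⟨ +-identityˡ _ ⟩
  coeff (0ℤ ∷ mulP P Q) k                             ∎
  where open ≡-Reasoning

mulP-shiftʳ : ∀ P Q → mulP P (0ℤ ∷ Q) ≋ (0ℤ ∷ mulP P Q)
mulP-shiftʳ P Q = ≋-trans (mulP-comm P (0ℤ ∷ Q)) (≋-trans (mulP-shiftˡ Q P) (∷-cong 0ℤ (mulP-comm Q P)))

mulP-assoc : ∀ P Q R → mulP (mulP P Q) R ≋ mulP P (mulP Q R)
mulP-assoc []       Q R = ≋-refl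
mulP-assoc (c ∷ cs) Q R =
  ≋-trans (mulP-distribʳ (scale c Q) (0ℤ ∷ mulP cs Q) R)
    (addP-cong (mulP-scaleˡ c Q R) (≋-trans (mulP-shiftˡ (mulP cs Q) R) (∷-cong 0ℤ (mulP-assoc cs Q R))))

coeff-[0] : ∀ k → coeff [ 0ℤ ] k ≡ 0ℤ
coeff-[0] zero    = refl
coeff-[0] (suc k) = refl

mulP-identityˡ : ∀ P → mulP [ 1ℤ ] P ≋ P
mulP-identityˡ P = mk≋ λ k → begin
  coeff (addP (scale 1ℤ P) [ 0ℤ ]) k    ≡⟨ coeff-addP (scale 1ℤ P) [ 0ℤ ] k ⟩
  coeff (scale 1ℤ P) k + coeff [ 0ℤ ] k ≡⟨ cong₂ _+_ (coeff-scale 1ℤ P k) (coeff-[0] k) ⟩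
  1ℤ * coeff P k + 0ℤ                   ≡⟨ +-identityʳ _ ⟩
  1ℤ * coeff P k                        ≡⟨ *-identityˡ _ ⟩
  coeff P k                             ∎
  where open ≡-Reasoning

mulP-identityʳ : ∀ P → mulP P [ 1ℤ ] ≋ P
mulP-identityʳ P = ≋-trans (mulP-comm P [ 1ℤ ]) (mulP-identityˡ P)

ℤ[X] : CommutativeRing 0ℓ 0ℓ
ℤ[X] = record
  { Carrier = Poly ; _≈_ = _≋_ ; _+_ = addP ; _*_ = mulP ; -_ = negP ; 0# = [] ; 1# = [ 1ℤ ]
  ; isCommutativeRing = record
    { isRing = record
      { +-isAbelianGroup = record
        { isGroup = record
          { isMonoid = record
            { isSemigroup = record
              { isMagma = record
                { isEquivalence = record { refl = ≋-refl ; sym = ≋-sym ; trans = ≋-trans }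
                ; ∙-cong = addP-cong }
              ; assoc = addP-assoc }
            ; identity = addP-identityˡ , addP-identityʳ }
          ; inverse = negP-inverseˡ , negP-inverseʳ
          ; ⁻¹-cong = scale-cong -1ℤ }
        ; comm = addP-comm }
      ; *-cong = mulP-cong
      ; *-assoc = mulP-assoc
      ; *-identity = mulP-identityˡ , mulP-identityʳ
      ; distrib = mulP-distribˡ , λ x y z → mulP-distribʳ y z x }
    ; *-comm = mulP-comm } }

≋[]? : ∀ P → Dec (P ≋ [])
≋[]? []       = yes ≋-refl
≋[]? (c ∷ cs) with c ℤ.≟ 0ℤ | ≋[]? cs
... | yes c≡0 | yes (mk≋ cs≡0) = yes (mk≋ λ { zero → c≡0 ; (suc k) → cs≡0 k })
... | no c≢0  | _              = no λ (mk≋ e) → c≢0 (e 0)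
... | _       | no cs≢0        = no λ (mk≋ e) → cs≢0 (mk≋ (e ∘ suc))

-- The solver has to recognise vanishing coefficients of its normal forms, hence the zero test.
ℤ[X]-ring : AlmostCommutativeRing 0ℓ 0ℓ
ℤ[X]-ring = fromCommutativeRing ℤ[X] λ P → dec⇒maybe (map′ ≋-sym ≋-sym (≋[]? P))

module ≋-Reasoning = SetoidReasoning (CommutativeRing.setoid ℤ[X])

open import Tactic.RingSolver.NonReflective ℤ[X]-ring using (solve; _⊜_; _⊕_; _⊗_; ⊝_)

DegreeBelow : Poly → ℕ → Set
DegreeBelow P d = ∀ k → d ≤ k → coeff P k ≡ 0ℤ

HasDegree : Poly → ℕ → Set
HasDegree P e = coeff P e ≢ 0ℤ × DegreeBelow P (suc e)

degreeBelow-weaken : ∀ {P d d′} → d ≤ d′ → DegreeBelow P d → DegreeBelow P d′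
degreeBelow-weaken d≤d′ P<d k d′≤k = P<d k (ℕₚ.≤-trans d≤d′ d′≤k)

degreeBelow-length : ∀ P → DegreeBelow P (length P)
degreeBelow-length []       k       _         = refl
degreeBelow-length (c ∷ cs) (suc k) (s≤s l≤k) = degreeBelow-length cs k l≤k

degreeBelow-mulP : ∀ A B a b → DegreeBelow A (suc a) → DegreeBelow B (suc b) → DegreeBelow (mulP A B) (suc (a ℕ.+ b))
degreeBelow-mulP A B a b A<a B<b k a+b<k =
  trans (coeff-mulP A B k) (convolution-above (coeff A) (coeff B) a b A<a B<b k a+b<k)

coeff-mulP-top : ∀ A B a b → DegreeBelow A (suc a) → DegreeBelow B (suc b) →
                 coeff (mulP A B) (a ℕ.+ b) ≡ coeff A a * coeff B b
coeff-mulP-top A B a b A<a B<b =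
  trans (coeff-mulP A B (a ℕ.+ b)) (convolution-top (coeff A) (coeff B) a b A<a B<b)

hasDegree-mulP : ∀ A B a b → HasDegree A a → HasDegree B b → HasDegree (mulP A B) (a ℕ.+ b)
hasDegree-mulP A B a b (Aₐ≢0 , A<a+1) (B_b≢0 , B<b+1) =
  (λ AB≡0 → Sum.[ Aₐ≢0 , B_b≢0 ] (i*j≡0⇒i≡0∨j≡0 (coeff A a) (trans (sym (coeff-mulP-top A B a b A<a+1 B<b+1)) AB≡0)))
  , degreeBelow-mulP A B a b A<a+1 B<b+1

degree-below : ∀ d P → DegreeBelow P d → ¬ P ≋ [] → Σ ℕ λ e → e < d × HasDegree P e
degree-below zero    P P<0 P≢0 = ⊥-elim (P≢0 (mk≋ λ k → P<0 k z≤n))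
degree-below (suc d) P P<d+1 P≢0 with coeff P d ℤ.≟ 0ℤ
... | no Pd≢0 = d , ℕₚ.≤-refl , Pd≢0 , P<d+1
... | yes Pd≡0 with degree-below d P P<d P≢0
  where
  P<d : DegreeBelow P d
  P<d k d≤k with ℕₚ.m≤n⇒m<n∨m≡n d≤k
  ... | inj₁ d<k  = P<d+1 k d<k
  ... | inj₂ refl = Pd≡0
... | e , e<d , deg = e , ℕₚ.m≤n⇒m≤1+n e<d , deg

degree : ∀ P → ¬ P ≋ [] → Σ ℕ (HasDegree P)
degree P P≢0 with degree-below (length P) P (degreeBelow-length P) P≢0
... | e , _ , deg = e , deg

degreeBelow-∷ : ∀ {P d} c → DegreeBelow P d → DegreeBelow (c ∷ P) (suc d)
degreeBelow-∷ c P<d (suc k) (s≤s d≤k) = P<d k d≤k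

X^_ : ℕ → Poly
X^ zero  = [ 1ℤ ]
X^ suc d = 0ℤ ∷ X^ d

coeff-X^ : ∀ d → coeff (X^ d) d ≡ 1ℤ
coeff-X^ zero    = refl
coeff-X^ (suc d) = coeff-X^ d

degreeBelow-X^ : ∀ d → DegreeBelow (X^ d) (suc d)
degreeBelow-X^ zero    (suc k) _         = refl
degreeBelow-X^ (suc d) (suc k) (s≤s d<k) = degreeBelow-X^ d k d<k

coeff-constˡ : ∀ c P k → coeff (mulP [ c ] P) k ≡ c * coeff P k
coeff-constˡ c P k = begin
  coeff (addP (scale c P) [ 0ℤ ]) k     ≡⟨ coeff-addP (scale c P) [ 0ℤ ] k ⟩
  coeff (scale c P) k + coeff [ 0ℤ ] k ≡⟨ cong₂ _+_ (coeff-scale c P k) (coeff-[0] k) ⟩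
  c * coeff P k + 0ℤ                   ≡⟨ +-identityʳ _ ⟩
  c * coeff P k                        ∎
  where open ≡-Reasoning

mulP-constˡ : ∀ c P → mulP [ c ] P ≋ scale c P
mulP-constˡ c P = mk≋ λ k → trans (coeff-constˡ c P k) (sym (coeff-scale c P k))

mulP-const : ∀ a b → mulP [ a ] [ b ] ≋ [ a * b ]
mulP-const a b = mulP-constˡ a [ b ]

record PseudoDivision (G : Poly) (e : ℕ) (P : Poly) : Set where
  constructor pseudoDivision
  field
    power              : ℕ
    quotient remainder : Poly
    identity           : mulP [ coeff G e ^ power ] P ≋ addP (mulP quotient G) remainder
    remainder<e        : DegreeBelow remainder e

module _ (G : Poly) (e : ℕ) (G<e+1 : DegreeBelow G (suc e)) where

  private
    g = coeff G e

  leading-cancel : ∀ D P → e ≤ D → DegreeBelow P (suc D) →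
    DegreeBelow (addP (mulP [ g ] P) (negP (mulP [ coeff P D ] (mulP (X^ (D ∸ e)) G)))) D
  leading-cancel D P e≤D P<D+1 k D≤k = begin
    coeff (addP (mulP [ g ] P) (negP (mulP [ h ] T))) k   ≡⟨ coeff-addP (mulP [ g ] P) _ k ⟩
    coeff (mulP [ g ] P) k + coeff (negP (mulP [ h ] T)) k ≡⟨ cong₂ _+_ (coeff-constˡ g P k)
                                                              (trans (coeff-scale -1ℤ (mulP [ h ] T) k) (cong (-1ℤ *_) (coeff-constˡ h T k))) ⟩
    g * coeff P k + -1ℤ * (h * coeff T k)                  ≡⟨ top-cancels (ℕₚ.m≤n⇒m<n∨m≡n D≤k) ⟩
    0ℤ                                                     ∎
    where
    open ≡-Reasoning
    h = coeff P D
    T = mulP (X^ (D ∸ e)) G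
    d+e≡D : D ∸ e ℕ.+ e ≡ D
    d+e≡D = ℕₚ.m∸n+n≡m e≤D
    T<D+1 : DegreeBelow T (suc D)
    T<D+1 = subst (λ x → DegreeBelow T (suc x)) d+e≡D (degreeBelow-mulP (X^ (D ∸ e)) G (D ∸ e) e (degreeBelow-X^ (D ∸ e)) G<e+1)
    T-top : coeff T D ≡ g
    T-top = begin
      coeff T D                               ≡⟨ cong (coeff T) d+e≡D ⟨
      coeff T (D ∸ e ℕ.+ e)                   ≡⟨ coeff-mulP-top (X^ (D ∸ e)) G (D ∸ e) e (degreeBelow-X^ (D ∸ e)) G<e+1 ⟩
      coeff (X^ (D ∸ e)) (D ∸ e) * g          ≡⟨ cong (_* g) (coeff-X^ (D ∸ e)) ⟩
      1ℤ * g                                  ≡⟨ *-identityˡ g ⟩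
      g                                       ∎
    top-cancels : D < k ⊎ D ≡ k → g * coeff P k + -1ℤ * (h * coeff T k) ≡ 0ℤ
    top-cancels (inj₁ D<k) = trans (cong₂ (λ x y → g * x + -1ℤ * (h * y)) (P<D+1 k D<k) (T<D+1 k D<k)) (zeros g h)
      where zeros : ∀ g h → g * 0ℤ + -1ℤ * (h * 0ℤ) ≡ 0ℤ
            zeros = solve-∀
    top-cancels (inj₂ refl) = trans (cong (λ y → g * h + -1ℤ * (h * y)) T-top) (cancel g h)
      where cancel : ∀ g h → g * h + -1ℤ * (h * g) ≡ 0ℤ
            cancel = solve-∀

  pseudo-divide : ∀ D P → DegreeBelow P D → PseudoDivision G e P
  pseudo-divide D P P<D with D ℕₚ.≤? e
  ... | yes D≤e = pseudoDivision 0 [] P (mulP-identityˡ P) (degreeBelow-weaken {P} D≤e P<D)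
  pseudo-divide zero    P P<D | no D≰e = ⊥-elim (D≰e z≤n)
  pseudo-divide (suc D) P P<D | no D≰e = lift (pseudo-divide D P′ (leading-cancel D P e≤D P<D))
    where
    e≤D : e ≤ D
    e≤D = ℕₚ.≤-pred (ℕₚ.≰⇒> D≰e)
    h = coeff P D
    T = mulP (X^ (D ∸ e)) G
    P′ = addP (mulP [ g ] P) (negP (mulP [ h ] T))
    lift : PseudoDivision G e P′ → PseudoDivision G e P
    lift (pseudoDivision k Q R eq R<e) = pseudoDivision (suc k) (addP Q (mulP [ g ^ k * h ] (X^ (D ∸ e)))) R eq′ R<e
      where
      open ≋-Reasoning
      split : ∀ Γ Γᵏ H P T → mulP (mulP Γ Γᵏ) P ≋ addP (mulP Γᵏ (addP (mulP Γ P) (negP (mulP H T)))) (mulP (mulP Γᵏ H) T)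
      split = solve 5 (λ Γ Γᵏ H P T → (Γ ⊗ Γᵏ) ⊗ P ⊜ (Γᵏ ⊗ (Γ ⊗ P ⊕ ⊝ (H ⊗ T)) ⊕ (Γᵏ ⊗ H) ⊗ T)) ≋-refl
      regroup : ∀ Q G R C Y → addP (addP (mulP Q G) R) (mulP C (mulP Y G)) ≋ addP (mulP (addP Q (mulP C Y)) G) R
      regroup = solve 5 (λ Q G R C Y → ((Q ⊗ G ⊕ R) ⊕ C ⊗ (Y ⊗ G)) ⊜ ((Q ⊕ C ⊗ Y) ⊗ G ⊕ R)) ≋-refl
      eq′ : mulP [ g ^ suc k ] P ≋ addP (mulP (addP Q (mulP [ g ^ k * h ] (X^ (D ∸ e)))) G) R
      eq′ = begin
        mulP [ g * g ^ k ] P                                ≈⟨ mulP-cong (≋-sym (mulP-const g (g ^ k))) (≋-refl {P}) ⟩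
        mulP (mulP [ g ] [ g ^ k ]) P                       ≈⟨ split [ g ] [ g ^ k ] [ h ] P T ⟩
        addP (mulP [ g ^ k ] P′) (mulP (mulP [ g ^ k ] [ h ]) T) ≈⟨ addP-cong eq (mulP-cong (mulP-const (g ^ k) h) (≋-refl {T})) ⟩
        addP (addP (mulP Q G) R) (mulP [ g ^ k * h ] T)      ≈⟨ regroup Q G R [ g ^ k * h ] (X^ (D ∸ e)) ⟩
        addP (mulP (addP Q (mulP [ g ^ k * h ] (X^ (D ∸ e)))) G) R ∎

prime-divisor : ∀ n → 2 ≤ n → Σ ℕ λ q → Prime q × q ℕᵈ.∣ n
prime-divisor n 2≤n with factorise n {{ℕ.>-nonZero (ℕₚ.<-trans (s≤s z≤n) 2≤n)}}
... | record { factors = [] ; isFactorisation = n≡1 } = ⊥-elim (ℕₚ.<-irrefl (sym n≡1) 2≤n)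
... | record { factors = q ∷ qs ; isFactorisation = n≡q*qs ; factorsPrime = q-prime ∷ᴬ _ } =
  q , q-prime , ℕᵈ.divides (product qs) (trans n≡q*qs (ℕₚ.*-comm q (product qs)))

euclidsLemma-ℤ : ∀ {q} → Prime q → ∀ a b → + q ∣ₛ a * b → + q ∣ₛ a ⊎ + q ∣ₛ b
euclidsLemma-ℤ q-prime a b q∣ab =
  Sum.map ∣ᵤ⇒∣ ∣ᵤ⇒∣ (euclidsLemma ℤ.∣ a ∣ ℤ.∣ b ∣ q-prime (subst (_ ℕᵈ.∣_) (abs-* a b) (∣⇒∣ᵤ q∣ab)))

infix 4 _∣ₚ_ _∣ₚ?_

_∣ₚ_ : ℤ → Poly → Set
d ∣ₚ P = ∀ k → d ∣ₛ coeff P k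

_∣ₚ?_ : ∀ d P → Dec (d ∣ₚ P)
d ∣ₚ? []       = yes λ _ → divides 0ℤ refl
d ∣ₚ? (c ∷ cs) with d ∣? c | d ∣ₚ? cs
... | yes d∣c | yes d∣cs = yes λ { zero → d∣c ; (suc k) → d∣cs k }
... | no d∤c  | _        = no λ d∣ → d∤c (d∣ 0)
... | _       | no d∤cs  = no λ d∣ → d∤cs (d∣ ∘ suc)

lowest-nondivisible : ∀ d P → ¬ d ∣ₚ P → Σ ℕ λ i → ¬ d ∣ₛ coeff P i × (∀ t → t < i → d ∣ₛ coeff P t)
lowest-nondivisible d []       d∤P = ⊥-elim (d∤P λ _ → divides 0ℤ refl)
lowest-nondivisible d (c ∷ cs) d∤P with d ∣? c
... | no d∤c  = 0 , d∤c , λ _ ()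
... | yes d∣c with lowest-nondivisible d cs (λ d∣cs → d∤P λ { zero → d∣c ; (suc k) → d∣cs k })
... | i , d∤csᵢ , d∣cs<i = suc i , d∤csᵢ , λ { zero _ → d∣c ; (suc t) (s≤s t<i) → d∣cs<i t t<i }

prime-∣ₚ-mulP : ∀ {q} → Prime q → ∀ A B → + q ∣ₚ mulP A B → + q ∣ₚ A ⊎ + q ∣ₚ B
prime-∣ₚ-mulP {q} q-prime A B q∣AB with + q ∣ₚ? A | + q ∣ₚ? B
... | yes q∣A | _       = inj₁ q∣A
... | no _    | yes q∣B = inj₂ q∣B
... | no q∤A  | no q∤B with lowest-nondivisible _ A q∤A | lowest-nondivisible _ B q∤B
... | i , q∤Aᵢ , q∣A<i | j , q∤Bⱼ , q∣B<j =
  ⊥-elim (Sum.[ q∤Aᵢ , q∤Bⱼ ] (euclidsLemma-ℤ q-prime (coeff A i) (coeff B j)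
    (∣-convolution⇒∣-product (coeff A) (coeff B) i j q∣A<i q∣B<j
      (subst (_ ∣ₛ_) (coeff-mulP A B (i ℕ.+ j)) (q∣AB (i ℕ.+ j))))))

∣ₚ⇒scale : ∀ {d} P → d ∣ₚ P → Σ Poly λ P′ → P ≋ scale d P′
∣ₚ⇒scale []       _   = [] , ≋-refl
∣ₚ⇒scale (c ∷ cs) d∣P with d∣P 0 | ∣ₚ⇒scale cs (d∣P ∘ suc)
... | divides c′ c≡c′d | cs′ , mk≋ cs≋ = c′ ∷ cs′ , mk≋ λ { zero → trans c≡c′d (*-comm c′ _) ; (suc k) → cs≋ k }

scale-assoc : ∀ a b P → scale a (scale b P) ≋ scale (a * b) P
scale-assoc a b P = mk≋ λ k → begin
  coeff (scale a (scale b P)) k ≡⟨ coeff-scale a (scale b P) k ⟩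
  a * coeff (scale b P) k       ≡⟨ cong (a *_) (coeff-scale b P k) ⟩
  a * (b * coeff P k)           ≡⟨ *-assoc a b (coeff P k) ⟨
  a * b * coeff P k             ≡⟨ coeff-scale (a * b) P k ⟨
  coeff (scale (a * b) P) k     ∎
  where open ≡-Reasoning

scale-identity : ∀ P → scale 1ℤ P ≋ P
scale-identity P = mk≋ λ k → trans (coeff-scale 1ℤ P k) (*-identityˡ (coeff P k))

scale-cancel : ∀ {c P Q} → c ≢ 0ℤ → scale c P ≋ scale c Q → P ≋ Q
scale-cancel {c} {P} {Q} c≢0 (mk≋ e) = mk≋ λ k →
  *-cancelˡ-≡ c (coeff P k) (coeff Q k) {{ℤ.≢-nonZero c≢0}}
    (trans (sym (coeff-scale c P k)) (trans (e k) (coeff-scale c Q k)))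

Nonconstant : Poly → Set
Nonconstant P = Σ ℕ λ k → 0 < k × coeff P k ≢ 0ℤ

unit⇒¬nonconstant : ∀ {P} → IsUnitP P → ¬ Nonconstant P
unit⇒¬nonconstant (inj₁ P≈1)  (suc k , _ , Pₖ≢0) = Pₖ≢0 (P≈1 (suc k))
unit⇒¬nonconstant (inj₂ P≈-1) (suc k , _ , Pₖ≢0) = Pₖ≢0 (P≈-1 (suc k))

nonconstant-≋ : ∀ {P Q} → P ≋ Q → Nonconstant P → Nonconstant Q
nonconstant-≋ (mk≋ e) (k , 0<k , Pₖ≢0) = k , 0<k , Pₖ≢0 ∘ trans (e k)

nonconstant-scale : ∀ {c P} → c ≢ 0ℤ → Nonconstant P → Nonconstant (scale c P)
nonconstant-scale {c} {P} c≢0 (k , 0<k , Pₖ≢0) = k , 0<k , λ cPₖ≡0 →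
  Sum.[ c≢0 , Pₖ≢0 ] (i*j≡0⇒i≡0∨j≡0 c (trans (sym (coeff-scale c P k)) cPₖ≡0))

nonconstant-scale⁻¹ : ∀ {c P} → Nonconstant (scale c P) → Nonconstant P
nonconstant-scale⁻¹ {c} {P} (k , 0<k , cPₖ≢0) = k , 0<k , λ Pₖ≡0 →
  cPₖ≢0 (trans (coeff-scale c P k) (trans (cong (c *_) Pₖ≡0) (*-zeroʳ c)))

record Splitting (E : Poly) (m : ℤ) : Set where
  constructor splitting
  field
    left right        : Poly
    factorises        : scale m E ≋ mulP left right
    left-nonconstant  : Nonconstant left
    right-nonconstant : Nonconstant right

splitting-swap : ∀ {E m} → Splitting E m → Splitting E m
splitting-swap (splitting A B eq ncA ncB) = splitting B A (≋-trans eq (mulP-comm A B)) ncB ncA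

module _ {E : Poly} {m m′ : ℤ} {q : ℕ} (m≡m′q : m ≡ m′ * + q) where

  splitting-∣ₚ : (S : Splitting E m) → + q ∣ₚ mulP (Splitting.left S) (Splitting.right S)
  splitting-∣ₚ S k = subst (_ ∣ₛ_) (trans (sym (coeff-scale m E k)) (coeff-≡ (Splitting.factorises S) k))
                       (∣m⇒∣m*n (coeff E k) (divides m′ m≡m′q))

  splitting-divideˡ : + q ≢ 0ℤ → (S : Splitting E m) → + q ∣ₚ Splitting.left S → Splitting E m′
  splitting-divideˡ q≢0 (splitting A B eq ncA ncB) q∣A with ∣ₚ⇒scale A q∣A
  ... | A′ , A≋qA′ = splitting A′ B (scale-cancel q≢0 qm′E≋qA′B) (nonconstant-scale⁻¹ {+ q} {A′} (nonconstant-≋ A≋qA′ ncA)) ncB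
    where
    open ≋-Reasoning
    qm′E≋qA′B : scale (+ q) (scale m′ E) ≋ scale (+ q) (mulP A′ B)
    qm′E≋qA′B = begin
      scale (+ q) (scale m′ E)   ≈⟨ scale-assoc (+ q) m′ E ⟩
      scale (+ q * m′) E         ≡⟨ cong (λ c → scale c E) (trans (*-comm (+ q) m′) (sym m≡m′q)) ⟩
      scale m E                  ≈⟨ eq ⟩
      mulP A B                   ≈⟨ mulP-cong A≋qA′ (≋-refl {B}) ⟩
      mulP (scale (+ q) A′) B    ≈⟨ mulP-scaleˡ (+ q) A′ B ⟩
      scale (+ q) (mulP A′ B)    ∎

  splitting-divide : Prime q → Splitting E m → Splitting E m′
  splitting-divide q-prime S = Sum.[ splitting-divideˡ q≢0 S
                                    , (λ q∣B → splitting-swap (splitting-divideˡ q≢0 (splitting-swap S) q∣B)) ]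
    (prime-∣ₚ-mulP q-prime (Splitting.left S) (Splitting.right S) (splitting-∣ₚ S))
    where
    q≢0 : + q ≢ 0ℤ
    q≢0 q≡0 = ℕ.≢-nonZero⁻¹ q {{prime⇒nonZero q-prime}} (+-injective q≡0)

module _ {E : Poly} (E-irreducible : ∀ F G → E ≈P mulP F G → IsUnitP F ⊎ IsUnitP G) where

  ¬splitting-unit : ∀ {m} → m * m ≡ 1ℤ → ¬ Splitting E m
  ¬splitting-unit {m} m²≡1 (splitting A B eq ncA ncB) =
    Sum.[ (λ u → unit⇒¬nonconstant {scale m A} u (nonconstant-scale {m} {A} m≢0 ncA)) , (λ u → unit⇒¬nonconstant {B} u ncB) ]
      (E-irreducible (scale m A) B (coeff-≡ E≋mA·B))
    where
    open ≋-Reasoning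
    m≢0 : m ≢ 0ℤ
    m≢0 m≡0 with () ← trans (sym m²≡1) (cong (λ x → x * x) m≡0)
    E≋mA·B : E ≋ mulP (scale m A) B
    E≋mA·B = begin
      E                    ≈⟨ scale-identity E ⟨
      scale 1ℤ E           ≡⟨ cong (λ c → scale c E) m²≡1 ⟨
      scale (m * m) E      ≈⟨ scale-assoc m m E ⟨
      scale m (scale m E)  ≈⟨ scale-cong m eq ⟩
      scale m (mulP A B)   ≈⟨ mulP-scaleˡ m A B ⟨
      mulP (scale m A) B   ∎

  ¬splitting : ∀ {m} → m ≢ 0ℤ → ¬ Splitting E m
  ¬splitting {m} = <-rec Small step ℤ.∣ m ∣ refl
    where
    Small : ℕ → Set
    Small n = ∀ {m} → ℤ.∣ m ∣ ≡ n → m ≢ 0ℤ → ¬ Splitting E m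

    descend : ∀ {m} → 2 ≤ ℤ.∣ m ∣ → (∀ {n} → n < ℤ.∣ m ∣ → Small n) → ¬ Splitting E m
    descend {m} 2≤∣m∣ rec S with prime-divisor ℤ.∣ m ∣ 2≤∣m∣
    ... | q , q-prime , q∣∣m∣ with ∣ᵤ⇒∣ {+ q} {m} q∣∣m∣
    ... | divides m′ m≡m′q = rec ∣m′∣<∣m∣ refl m′≢0 (splitting-divide m≡m′q q-prime S)
      where
      ∣m∣≡∣m′∣q : ℤ.∣ m ∣ ≡ ℤ.∣ m′ ∣ ℕ.* q
      ∣m∣≡∣m′∣q = trans (cong ℤ.∣_∣ m≡m′q) (abs-* m′ (+ q))
      m′≢0 : m′ ≢ 0ℤ
      m′≢0 refl = ℕₚ.<⇒≢ (ℕₚ.<-trans (s≤s z≤n) 2≤∣m∣) (sym ∣m∣≡∣m′∣q)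
      ∣m′∣<∣m∣ : ℤ.∣ m′ ∣ < ℤ.∣ m ∣
      ∣m′∣<∣m∣ = subst (ℤ.∣ m′ ∣ <_) (sym ∣m∣≡∣m′∣q)
        (ℕₚ.m<m*n ℤ.∣ m′ ∣ q {{ℕ.≢-nonZero (m′≢0 ∘ ∣i∣≡0⇒i≡0)}} (ℕ.nonTrivial⇒n>1 q {{prime⇒nonTrivial q-prime}}))

    step : ∀ n → (∀ {n′} → n′ < n → Small n′) → Small n
    step _ _   {+0}              _    m≢0 = ⊥-elim (m≢0 refl)
    step _ _   {+[1+ 0 ]}        _    _   = ¬splitting-unit refl
    step _ _   { -[1+ 0 ]}       _    _   = ¬splitting-unit refl
    step _ rec {+[1+ suc _ ]}    refl _   = descend (s≤s (s≤s z≤n)) rec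
    step _ rec { -[1+ suc _ ]}   refl _   = descend (s≤s (s≤s z≤n)) rec

remainder-annihilates : ∀ C E Q′ G R F Q → mulP C E ≋ addP (mulP Q′ G) R → mulP G F ≋ mulP E Q →
                        mulP R F ≋ mulP E (addP (mulP C F) (negP (mulP Q′ Q)))
remainder-annihilates C E Q′ G R F Q CE≋Q′G+R GF≋EQ = begin
  mulP R F                                                 ≈⟨ isolate-R Q′ G R F ⟩
  addP (mulP (addP (mulP Q′ G) R) F) (negP (mulP Q′ (mulP G F)))
     ≈⟨ addP-cong (mulP-cong (≋-sym CE≋Q′G+R) (≋-refl {F})) (scale-cong -1ℤ (mulP-cong (≋-refl {Q′}) GF≋EQ)) ⟩
  addP (mulP (mulP C E) F) (negP (mulP Q′ (mulP E Q)))      ≈⟨ factor-E C E Q′ F Q ⟩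
  mulP E (addP (mulP C F) (negP (mulP Q′ Q)))              ∎
  where
  open ≋-Reasoning
  isolate-R : ∀ Q′ G R F → mulP R F ≋ addP (mulP (addP (mulP Q′ G) R) F) (negP (mulP Q′ (mulP G F)))
  isolate-R = solve 4 (λ Q′ G R F → (R ⊗ F) ⊜ ((Q′ ⊗ G ⊕ R) ⊗ F ⊕ ⊝ (Q′ ⊗ (G ⊗ F)))) ≋-refl
  factor-E : ∀ C E Q′ F Q → addP (mulP (mulP C E) F) (negP (mulP Q′ (mulP E Q))) ≋ mulP E (addP (mulP C F) (negP (mulP Q′ Q)))
  factor-E = solve 5 (λ C E Q′ F Q → ((C ⊗ E) ⊗ F ⊕ ⊝ (Q′ ⊗ (E ⊗ Q))) ⊜ (E ⊗ (C ⊗ F ⊕ ⊝ (Q′ ⊗ Q)))) ≋-refl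

module _ {n : ℕ} (E : Poly) (E-monic : coeff E n ≡ 1ℤ) (E<n+1 : DegreeBelow E (suc n)) where

  E-degree : HasDegree E n
  E-degree = (λ Eₙ≡0 → 1≢0 (trans (sym E-monic) Eₙ≡0)) , E<n+1
    where 1≢0 : 1ℤ ≢ 0ℤ
          1≢0 ()

  monic-multiple-degree : ∀ {P} d Q → HasDegree P d → P ≋ mulP E Q → n ≤ d
  monic-multiple-degree {P} d Q (P_d≢0 , P<d+1) P≋EQ with ≋[]? Q
  ... | yes Q≋0 = ⊥-elim (P_d≢0 (trans (coeff-≡ P≋EQ d) (coeff-≡ (≋-trans (mulP-comm E Q) (mulP-cong Q≋0 (≋-refl {E}))) d)))
  ... | no Q≢0 with degree Q Q≢0
  ... | t , Q-deg with ℕₚ.<-≤-connex d (n ℕ.+ t)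
  ... | inj₂ n+t≤d = ℕₚ.≤-trans (ℕₚ.m≤m+n n t) n+t≤d
  ... | inj₁ d<n+t = ⊥-elim (proj₁ (hasDegree-mulP E Q n t E-degree Q-deg) (trans (sym (coeff-≡ P≋EQ (n ℕ.+ t))) (P<d+1 _ d<n+t)))

  multiple-top≢0 : ∀ {c P} → c ≢ 0ℤ → scale c E ≋ P → coeff P n ≢ 0ℤ
  multiple-top≢0 {c} {P} c≢0 cE≋P Pₙ≡0 = c≢0 (begin
    c                     ≡⟨ *-identityʳ c ⟨
    c * 1ℤ                ≡⟨ cong (c *_) E-monic ⟨
    c * coeff E n         ≡⟨ coeff-scale c E n ⟨
    coeff (scale c E) n   ≡⟨ coeff-≡ cE≋P n ⟩
    coeff P n             ≡⟨ Pₙ≡0 ⟩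
    0ℤ                    ∎)
    where open ≡-Reasoning

  cofactor-nonconstant : ∀ {c G Q e} → c ≢ 0ℤ → DegreeBelow G (suc e) → e < n → scale c E ≋ mulP Q G → Nonconstant Q
  cofactor-nonconstant {G = G} {Q} {e} c≢0 G<e+1 e<n cE≋QG with ≋[]? Q
  ... | yes Q≋0 = ⊥-elim (multiple-top≢0 c≢0 cE≋QG (coeff-≡ (mulP-cong Q≋0 (≋-refl {G})) n))
  ... | no Q≢0 with degree Q Q≢0
  ... | zero  , _ , Q<1  = ⊥-elim (multiple-top≢0 c≢0 cE≋QG (degreeBelow-mulP Q G 0 e Q<1 G<e+1 n e<n))
  ... | suc t , Qₜ≢0 , _ = suc t , s≤s z≤n , Qₜ≢0

  module _ (E-irreducible : ∀ F G → E ≈P mulP F G → IsUnitP F ⊎ IsUnitP G) (F : Poly)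
           (F<n : DegreeBelow F n) (F≢0 : ¬ F ≋ []) where

    private
      f = proj₁ (degree F F≢0)
      F-deg = proj₂ (degree F F≢0)
      f<n : f < n
      f<n with ℕₚ.<-≤-connex f n
      ... | inj₁ f<n = f<n
      ... | inj₂ n≤f = ⊥-elim (proj₁ F-deg (F<n f n≤f))

    ¬monic∣mulP : ∀ D {G} → D ≤ n → DegreeBelow G D → ¬ G ≋ [] → ∀ Q → ¬ mulP G F ≋ mulP E Q
    ¬monic∣mulP zero    _   G<0   G≢0 _ _ = G≢0 (mk≋ λ k → G<0 k z≤n)
    ¬monic∣mulP (suc D) {G} D<n G<D+1 G≢0 Q GF≋EQ with degree-below (suc D) G G<D+1 G≢0
    ... | zero  , _ , G-deg =
      ℕₚ.<⇒≱ f<n (monic-multiple-degree f Q (hasDegree-mulP G F 0 f G-deg F-deg) GF≋EQ)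
    ... | suc e , s≤s e<D , G-deg@(g≢0 , G<e+2) with pseudo-divide G (suc e) G<e+2 (suc n) E E<n+1
    ... | pseudoDivision k Q′ R E-divided R<e+1 with ≋[]? R
    ... | no R≢0 =
      ¬monic∣mulP D (ℕₚ.≤-trans (ℕₚ.n≤1+n D) D<n) (degreeBelow-weaken {R} e<D R<e+1) R≢0 _
        (remainder-annihilates [ coeff G (suc e) ^ k ] E Q′ G R F Q E-divided GF≋EQ)
    ... | yes R≋0 = ¬splitting E-irreducible gᵏ≢0
      (splitting Q′ G gᵏE≋Q′G (cofactor-nonconstant {G = G} {Q′} gᵏ≢0 G<e+2 (ℕₚ.<-≤-trans (s≤s e<D) D<n) gᵏE≋Q′G) (suc e , s≤s z≤n , g≢0))
      where
      g = coeff G (suc e)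
      gᵏ≢0 : g ^ k ≢ 0ℤ
      gᵏ≢0 = g≢0 ∘ i^n≡0⇒i≡0 g k
      gᵏE≋Q′G : scale (g ^ k) E ≋ mulP Q′ G
      gᵏE≋Q′G = begin
        scale (g ^ k) E               ≈⟨ mulP-constˡ (g ^ k) E ⟨
        mulP [ g ^ k ] E              ≈⟨ E-divided ⟩
        addP (mulP Q′ G) R            ≈⟨ addP-cong (≋-refl {mulP Q′ G}) R≋0 ⟩
        addP (mulP Q′ G) []           ≈⟨ addP-identityʳ (mulP Q′ G) ⟩
        mulP Q′ G                     ∎
        where open ≋-Reasoning

δ-refl : ∀ k → δ k k ≡ 1ℤ
δ-refl k with k ℕ.≟ k
... | yes _   = refl
... | no  k≢k = ⊥-elim (k≢k refl)

δ-≢ : ∀ {k l} → k ≢ l → δ k l ≡ 0ℤ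
δ-≢ {k} {l} k≢l with k ℕ.≟ l
... | yes k≡l = ⊥-elim (k≢l k≡l)
... | no  _   = refl

δ-suc : ∀ k l → δ (suc k) (suc l) ≡ δ k l
δ-suc k l with k ℕ.≟ l
... | yes refl = δ-refl (suc k)
... | no  k≢l  = δ-≢ (k≢l ∘ ℕₚ.suc-injective)

sumF-cong : ∀ {n} {f g : Fin n → ℤ} → (∀ i → f i ≡ g i) → sumF f ≡ sumF g
sumF-cong {zero}  _   = refl
sumF-cong {suc n} f≗g = cong₂ _+_ (f≗g fzero) (sumF-cong (f≗g ∘ fsuc))

sumF-zero : ∀ {n} {f : Fin n → ℤ} → (∀ i → f i ≡ 0ℤ) → sumF f ≡ 0ℤ
sumF-zero {zero}  _   = refl
sumF-zero {suc n} f≗0 = cong₂ _+_ (f≗0 fzero) (sumF-zero (f≗0 ∘ fsuc))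

toPoly : ∀ {n} → Vecℤ n → Poly
toPoly W = toList (tabulate W)

coeff-toPoly : ∀ {n} (W : Vecℤ n) j → coeff (toPoly W) (toℕ j) ≡ W j
coeff-toPoly W fzero    = refl
coeff-toPoly W (fsuc j) = coeff-toPoly (W ∘ fsuc) j

toPoly-degree : ∀ {n} (W : Vecℤ n) → DegreeBelow (toPoly W) n
toPoly-degree {zero}  W k       _         = refl
toPoly-degree {suc n} W (suc k) (s≤s n≤k) = toPoly-degree (W ∘ fsuc) k n≤k

toPoly-unique : ∀ {n} (W : Vecℤ n) P → (∀ j → W j ≡ coeff P (toℕ j)) → DegreeBelow P n → toPoly W ≋ P
toPoly-unique {n} W P W≡P P<n = mk≋ λ t → case-split t (ℕₚ.<-≤-connex t n)
  where
  case-split : ∀ t → t < n ⊎ n ≤ t → coeff (toPoly W) t ≡ coeff P t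
  case-split t (inj₁ t<n) = begin
    coeff (toPoly W) t                          ≡⟨ cong (coeff (toPoly W)) (Finₚ.toℕ-fromℕ< t<n) ⟨
    coeff (toPoly W) (toℕ (fromℕ< t<n))         ≡⟨ coeff-toPoly W (fromℕ< t<n) ⟩
    W (fromℕ< t<n)                              ≡⟨ W≡P (fromℕ< t<n) ⟩
    coeff P (toℕ (fromℕ< t<n))                  ≡⟨ cong (coeff P) (Finₚ.toℕ-fromℕ< t<n) ⟩
    coeff P t                                   ∎
    where open ≡-Reasoning
  case-split t (inj₂ n≤t) = trans (toPoly-degree W t n≤t) (sym (P<n t n≤t))

toPoly-zero : ∀ {n} {W : Vecℤ n} → (∀ j → W j ≡ 0ℤ) → toPoly W ≋ []
toPoly-zero {W = W} W≡0 = toPoly-unique W [] W≡0 (λ _ _ → refl)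

toPoly-cong : ∀ {n} {W W′ : Vecℤ n} → (∀ j → W j ≡ W′ j) → toPoly W ≋ toPoly W′
toPoly-cong {W = W} {W′} W≡W′ = toPoly-unique W (toPoly W′) (λ j → trans (W≡W′ j) (sym (coeff-toPoly W′ j))) (toPoly-degree W′)

toPoly-+ : ∀ {n} (W W′ : Vecℤ n) → toPoly (λ j → W j + W′ j) ≋ addP (toPoly W) (toPoly W′)
toPoly-+ {zero}  W W′ = ≋-refl
toPoly-+ {suc n} W W′ = ∷-cong (W fzero + W′ fzero) (toPoly-+ (W ∘ fsuc) (W′ ∘ fsuc))

toPoly-scale : ∀ {n} c (W : Vecℤ n) → toPoly (λ j → c * W j) ≋ scale c (toPoly W)
toPoly-scale {zero}  c W = ≋-refl
toPoly-scale {suc n} c W = ∷-cong (c * W fzero) (toPoly-scale c (W ∘ fsuc))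

sumF-δ : ∀ {n} (W : Vecℤ n) t → sumF (λ i → W i * δ t (toℕ i)) ≡ coeff (toPoly W) t
sumF-δ {zero}  W t       = refl
sumF-δ {suc n} W zero    = begin
  W fzero * δ 0 0 + sumF (λ i → W (fsuc i) * δ 0 (suc (toℕ i)))
    ≡⟨ cong₂ _+_ (trans (cong (W fzero *_) (δ-refl 0)) (*-identityʳ (W fzero)))
                 (sumF-zero λ i → trans (cong (W (fsuc i) *_) (δ-≢ {0} {suc (toℕ i)} (λ ()))) (*-zeroʳ (W (fsuc i)))) ⟩
  W fzero + 0ℤ
    ≡⟨ +-identityʳ (W fzero) ⟩
  W fzero ∎
  where open ≡-Reasoning
sumF-δ {suc n} W (suc t) = begin
  W fzero * δ (suc t) 0 + sumF (λ i → W (fsuc i) * δ (suc t) (suc (toℕ i)))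
    ≡⟨ cong₂ _+_ (trans (cong (W fzero *_) (δ-≢ {suc t} {0} (λ ()))) (*-zeroʳ (W fzero)))
                 (sumF-cong λ i → cong (W (fsuc i) *_) (δ-suc t (toℕ i))) ⟩
  0ℤ + sumF (λ i → W (fsuc i) * δ t (toℕ i))
    ≡⟨ +-identityˡ _ ⟩
  sumF (λ i → W (fsuc i) * δ t (toℕ i))
    ≡⟨ sumF-δ (W ∘ fsuc) t ⟩
  coeff (toPoly (W ∘ fsuc)) t ∎
  where open ≡-Reasoning

sumF-δ-suc : ∀ {n} (W : Vecℤ n) t → sumF (λ i → W i * δ t (suc (toℕ i))) ≡ coeff (0ℤ ∷ toPoly W) t
sumF-δ-suc W zero    = sumF-zero λ i → trans (cong (W i *_) (δ-≢ {0} {suc (toℕ i)} (λ ()))) (*-zeroʳ (W i))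
sumF-δ-suc W (suc t) = trans (sumF-cong λ i → cong (W i *_) (δ-suc t (toℕ i))) (sumF-δ W t)

sumF-+ : ∀ {n} (f g : Fin n → ℤ) → sumF (λ i → f i + g i) ≡ sumF f + sumF g
sumF-+ {zero}  f g = refl
sumF-+ {suc n} f g = trans (cong (_+_ (f fzero + g fzero)) (sumF-+ (f ∘ fsuc) (g ∘ fsuc)))
                           (interchange (f fzero) (g fzero) (sumF (f ∘ fsuc)) (sumF (g ∘ fsuc)))
  where interchange : ∀ a b c d → a + b + (c + d) ≡ a + c + (b + d)
        interchange = solve-∀

sumF-scale : ∀ {n} c (f : Fin n → ℤ) → sumF (λ i → c * f i) ≡ c * sumF f
sumF-scale {zero}  c f = sym (*-zeroʳ c)
sumF-scale {suc n} c f = trans (cong (_+_ (c * f fzero)) (sumF-scale c (f ∘ fsuc))) (sym (*-distribˡ-+ c (f fzero) _))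

coeff-monicPoly : ∀ {n} (a : Fin n → ℤ) j → coeff (monicPoly n a) (toℕ j) ≡ a j
coeff-monicPoly a fzero    = refl
coeff-monicPoly a (fsuc j) = coeff-monicPoly (a ∘ fsuc) j

monicPoly-monic : ∀ n (a : Fin n → ℤ) → coeff (monicPoly n a) n ≡ 1ℤ
monicPoly-monic zero    a = refl
monicPoly-monic (suc n) a = monicPoly-monic n (a ∘ fsuc)

monicPoly-degree : ∀ n (a : Fin n → ℤ) → DegreeBelow (monicPoly n a) (suc n)
monicPoly-degree zero    a (suc k) _         = refl
monicPoly-degree (suc n) a (suc k) (s≤s n<k) = monicPoly-degree n (a ∘ fsuc) k n<k

companion-entry : ∀ n a (i j : Fin n) → companion n a i j ≡ δ (toℕ j) (suc (toℕ i)) + (- a j) * δ n (suc (toℕ i))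
companion-entry n a i j with suc (toℕ i) ℕ.≟ n
... | yes i+1≡n = sym (begin
  δ (toℕ j) (suc (toℕ i)) + (- a j) * δ n (suc (toℕ i))
    ≡⟨ cong₂ (λ x y → x + (- a j) * y) (δ-≢ (λ j≡i+1 → ℕₚ.<⇒≢ (Finₚ.toℕ<n j) (trans j≡i+1 i+1≡n)))
                                        (trans (cong (δ n) i+1≡n) (δ-refl n)) ⟩
  0ℤ + (- a j) * 1ℤ
    ≡⟨ trans (+-identityˡ _) (*-identityʳ (- a j)) ⟩
  - a j ∎)
  where open ≡-Reasoning
... | no  i+1≢n = sym (begin
  δ (toℕ j) (suc (toℕ i)) + (- a j) * δ n (suc (toℕ i))
    ≡⟨ cong (_+_ (δ (toℕ j) (suc (toℕ i)))) (trans (cong ((- a j) *_) (δ-≢ (i+1≢n ∘ sym))) (*-zeroʳ (- a j))) ⟩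
  δ (toℕ j) (suc (toℕ i)) + 0ℤ
    ≡⟨ +-identityʳ _ ⟩
  δ (toℕ j) (suc (toℕ i)) ∎)
  where open ≡-Reasoning

module _ (n : ℕ) (a : Fin n → ℤ) (W : Vecℤ n) where

  private
    E = monicPoly n a
    w = coeff (0ℤ ∷ toPoly W) n
    XW-reduced = addP (0ℤ ∷ toPoly W) (scale (- w) E)

    coeff-XW-reduced : ∀ t → coeff XW-reduced t ≡ coeff (0ℤ ∷ toPoly W) t + (- w) * coeff E t
    coeff-XW-reduced t = trans (coeff-addP (0ℤ ∷ toPoly W) (scale (- w) E) t) (cong (_+_ (coeff (0ℤ ∷ toPoly W) t)) (coeff-scale (- w) E t))

    entry : ∀ j → vecMat W (companion n a) j ≡ coeff XW-reduced (toℕ j)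
    entry j = begin
      sumF (λ i → W i * companion n a i j)
        ≡⟨ sumF-cong (λ i → trans (cong (W i *_) (companion-entry n a i j)) (distribute (W i) _ (a j) _)) ⟩
      sumF (λ i → W i * δ (toℕ j) (suc (toℕ i)) + (- a j) * (W i * δ n (suc (toℕ i))))
        ≡⟨ trans (sumF-+ (λ i → W i * δ (toℕ j) (suc (toℕ i))) _) (cong (_+_ (sumF (λ i → W i * δ (toℕ j) (suc (toℕ i))))) (sumF-scale (- a j) (λ i → W i * δ n (suc (toℕ i))))) ⟩
      sumF (λ i → W i * δ (toℕ j) (suc (toℕ i))) + (- a j) * sumF (λ i → W i * δ n (suc (toℕ i)))
        ≡⟨ cong₂ (λ x y → x + (- a j) * y) (sumF-δ-suc W (toℕ j)) (sumF-δ-suc W n) ⟩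
      coeff (0ℤ ∷ toPoly W) (toℕ j) + (- a j) * w
        ≡⟨ cong (_+_ (coeff (0ℤ ∷ toPoly W) (toℕ j))) (trans (cong ((- w) *_) (coeff-monicPoly a j)) (neg-swap (a j) w)) ⟨
      coeff (0ℤ ∷ toPoly W) (toℕ j) + (- w) * coeff E (toℕ j)
        ≡⟨ coeff-XW-reduced (toℕ j) ⟨
      coeff XW-reduced (toℕ j) ∎
      where
      open ≡-Reasoning
      distribute : ∀ u d b e → u * (d + (- b) * e) ≡ u * d + (- b) * (u * e)
      distribute = solve-∀
      neg-swap : ∀ b w → (- w) * b ≡ (- b) * w
      neg-swap = solve-∀

    degree-XW-reduced : DegreeBelow XW-reduced n
    degree-XW-reduced t n≤t = trans (coeff-XW-reduced t) (vanish (ℕₚ.m≤n⇒m<n∨m≡n n≤t))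
      where
      vanish : n < t ⊎ n ≡ t → coeff (0ℤ ∷ toPoly W) t + (- w) * coeff E t ≡ 0ℤ
      vanish (inj₁ n<t) = trans (cong₂ (λ x y → x + (- w) * y) (degreeBelow-∷ 0ℤ (toPoly-degree W) t n<t) (monicPoly-degree n a t n<t))
                                (trans (+-identityˡ _) (*-zeroʳ (- w)))
      vanish (inj₂ refl) = trans (cong (λ y → w + (- w) * y) (monicPoly-monic n a)) (cancel w)
        where cancel : ∀ w → w + (- w) * 1ℤ ≡ 0ℤ
              cancel = solve-∀

  toPoly-companion : toPoly (vecMat W (companion n a)) ≋ addP (0ℤ ∷ toPoly W) (scale (- w) E)
  toPoly-companion = toPoly-unique _ XW-reduced entry degree-XW-reduced

infix 4 _≋_mod_

record _≋_mod_ (P Q E : Poly) : Set where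
  constructor modulo
  field
    multiplier : Poly
    congruence : P ≋ addP Q (mulP E multiplier)

module _ {E : Poly} where

  ≋⇒≋mod : ∀ {P Q} → P ≋ Q → P ≋ Q mod E
  ≋⇒≋mod {P} {Q} P≋Q = modulo [] (≋-trans P≋Q (≋-sym (≋-trans (addP-cong (≋-refl {Q}) (mulP-comm E [])) (addP-identityʳ Q))))

  mod-sym : ∀ {P Q} → P ≋ Q mod E → Q ≋ P mod E
  mod-sym {P} {Q} (modulo R P≋Q+ER) = modulo (negP R) (≋-trans (move Q E R) (addP-cong (≋-sym P≋Q+ER) (≋-refl {mulP E (negP R)})))
    where move : ∀ Q E R → Q ≋ addP (addP Q (mulP E R)) (mulP E (negP R))
          move = solve 3 (λ Q E R → Q ⊜ ((Q ⊕ E ⊗ R) ⊕ E ⊗ (⊝ R))) ≋-refl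

  mod-trans : ∀ {P Q S} → P ≋ Q mod E → Q ≋ S mod E → P ≋ S mod E
  mod-trans {P} {Q} {S} (modulo R₁ P≋Q+ER₁) (modulo R₂ Q≋S+ER₂) =
    modulo (addP R₂ R₁) (≋-trans P≋Q+ER₁ (≋-trans (addP-cong Q≋S+ER₂ (≋-refl {mulP E R₁})) (collect S E R₂ R₁)))
    where collect : ∀ S E R₂ R₁ → addP (addP S (mulP E R₂)) (mulP E R₁) ≋ addP S (mulP E (addP R₂ R₁))
          collect = solve 4 (λ S E R₂ R₁ → ((S ⊕ E ⊗ R₂) ⊕ E ⊗ R₁) ⊜ (S ⊕ E ⊗ (R₂ ⊕ R₁))) ≋-refl

  mod-setoid : Setoid 0ℓ 0ℓ
  mod-setoid = record
    { Carrier = Poly ; _≈_ = λ P Q → P ≋ Q mod E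
    ; isEquivalence = record { refl = λ {P} → ≋⇒≋mod (≋-refl {P}) ; sym = λ {P Q} → mod-sym {P} {Q} ; trans = λ {P Q S} → mod-trans {P} {Q} {S} } }

  mod-addP : ∀ {P P′ Q Q′} → P ≋ P′ mod E → Q ≋ Q′ mod E → addP P Q ≋ addP P′ Q′ mod E
  mod-addP {P} {P′} {Q} {Q′} (modulo R₁ P≋) (modulo R₂ Q≋) = modulo (addP R₁ R₂) (≋-trans (addP-cong P≋ Q≋) (collect P′ Q′ E R₁ R₂))
    where collect : ∀ P′ Q′ E R₁ R₂ → addP (addP P′ (mulP E R₁)) (addP Q′ (mulP E R₂)) ≋ addP (addP P′ Q′) (mulP E (addP R₁ R₂))
          collect = solve 5 (λ P′ Q′ E R₁ R₂ → ((P′ ⊕ E ⊗ R₁) ⊕ (Q′ ⊕ E ⊗ R₂)) ⊜ ((P′ ⊕ Q′) ⊕ E ⊗ (R₁ ⊕ R₂))) ≋-refl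

  mod-scale : ∀ c {P Q} → P ≋ Q mod E → scale c P ≋ scale c Q mod E
  mod-scale c {P} {Q} (modulo R P≋) = modulo (mulP [ c ] R) (begin
    scale c P                                      ≈⟨ mulP-constˡ c P ⟨
    mulP [ c ] P                                   ≈⟨ mulP-cong (≋-refl {[ c ]}) P≋ ⟩
    mulP [ c ] (addP Q (mulP E R))                 ≈⟨ distribute [ c ] Q E R ⟩
    addP (mulP [ c ] Q) (mulP E (mulP [ c ] R))    ≈⟨ addP-cong (mulP-constˡ c Q) (≋-refl {mulP E (mulP [ c ] R)}) ⟩
    addP (scale c Q) (mulP E (mulP [ c ] R))       ∎)
    where
    open ≋-Reasoning
    distribute : ∀ C Q E R → mulP C (addP Q (mulP E R)) ≋ addP (mulP C Q) (mulP E (mulP C R))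
    distribute = solve 4 (λ C Q E R → (C ⊗ (Q ⊕ E ⊗ R)) ⊜ (C ⊗ Q ⊕ E ⊗ (C ⊗ R))) ≋-refl

  mod-shift : ∀ {P Q} → P ≋ Q mod E → (0ℤ ∷ P) ≋ (0ℤ ∷ Q) mod E
  mod-shift {P} {Q} (modulo R P≋) = modulo (0ℤ ∷ R) (≋-trans (∷-cong 0ℤ P≋) (addP-cong (≋-refl {0ℤ ∷ Q}) (≋-sym (mulP-shiftʳ E R))))

module mod-Reasoning (E : Poly) = SetoidReasoning (mod-setoid {E})

module _ (n : ℕ) (a : Fin n → ℤ) where

  private
    E = monicPoly n a
    C = companion n a

  toPoly-companion-mod : ∀ W → toPoly (vecMat W C) ≋ (0ℤ ∷ toPoly W) mod E
  toPoly-companion-mod W = modulo [ - w ] (≋-trans (toPoly-companion n a W)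
    (addP-cong (≋-refl {0ℤ ∷ toPoly W}) (≋-trans (≋-sym (mulP-constˡ (- w) E)) (mulP-comm [ - w ] E))))
    where w = coeff (0ℤ ∷ toPoly W) n

  toPoly-power-mod : ∀ V k → toPoly (vecMatPow V C k) ≋ mulP (X^ k) (toPoly V) mod E
  toPoly-power-mod V zero    = ≋⇒≋mod (≋-sym (mulP-identityˡ (toPoly V)))
  toPoly-power-mod V (suc k) = begin
    toPoly (vecMat (vecMatPow V C k) C)  ≈⟨ toPoly-companion-mod (vecMatPow V C k) ⟩
    0ℤ ∷ toPoly (vecMatPow V C k)        ≈⟨ mod-shift (toPoly-power-mod V k) ⟩
    0ℤ ∷ mulP (X^ k) (toPoly V)          ≈⟨ ≋⇒≋mod (mulP-shiftˡ (X^ k) (toPoly V)) ⟨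
    mulP (X^ suc k) (toPoly V)           ∎
    where open mod-Reasoning E

toPoly-lincomb : ∀ {m n} {E U : Poly} (R : Fin m → Vecℤ n) → (∀ i → toPoly (R i) ≋ mulP (X^ toℕ i) U mod E) →
                 ∀ c → toPoly (λ j → sumF (λ i → c i * R i j)) ≋ mulP (toPoly c) U mod E
toPoly-lincomb {zero}  R _ c = ≋⇒≋mod (toPoly-zero (λ _ → refl))
toPoly-lincomb {suc m} {E = E} {U} R R≋XⁱU c = begin
  toPoly (λ j → c fzero * R fzero j + rest j)
    ≈⟨ ≋⇒≋mod (≋-trans (toPoly-+ _ rest) (addP-cong (toPoly-scale (c fzero) (R fzero)) (≋-refl {toPoly rest}))) ⟩
  addP (scale (c fzero) (toPoly (R fzero))) (toPoly rest)
    ≈⟨ mod-addP (mod-scale (c fzero) (mod-trans (R≋XⁱU fzero) (≋⇒≋mod (mulP-identityˡ U))))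
                (toPoly-lincomb (R ∘ fsuc) R′≋XⁱU′ (c ∘ fsuc)) ⟩
  addP (scale (c fzero) U) (mulP (toPoly (c ∘ fsuc)) (0ℤ ∷ U))
    ≈⟨ ≋⇒≋mod (addP-cong (≋-refl {scale (c fzero) U}) (mulP-shiftʳ (toPoly (c ∘ fsuc)) U)) ⟩
  mulP (toPoly c) U ∎
  where
  open mod-Reasoning E
  rest = λ j → sumF (λ i → c (fsuc i) * R (fsuc i) j)
  R′≋XⁱU′ : ∀ i → toPoly (R (fsuc i)) ≋ mulP (X^ toℕ i) (0ℤ ∷ U) mod E
  R′≋XⁱU′ i = mod-trans (R≋XⁱU (fsuc i))
    (≋⇒≋mod (≋-trans (mulP-shiftˡ (X^ toℕ i) U) (≋-sym (mulP-shiftʳ (X^ toℕ i) U))))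

evalP-addP : ∀ P Q x → evalP (addP P Q) x ≡ evalP P x + evalP Q x
evalP-addP []       Q        x = sym (+-identityˡ _)
evalP-addP (c ∷ cs) []       x = sym (+-identityʳ _)
evalP-addP (c ∷ cs) (d ∷ ds) x =
  trans (cong (λ y → c + d + x * y) (evalP-addP cs ds x)) (regroup c d x (evalP cs x) (evalP ds x))
  where regroup : ∀ c d x u v → c + d + x * (u + v) ≡ c + x * u + (d + x * v)
        regroup = solve-∀

evalP-scale : ∀ c P x → evalP (scale c P) x ≡ c * evalP P x
evalP-scale c []       x = sym (*-zeroʳ c)
evalP-scale c (d ∷ ds) x = trans (cong (λ y → c * d + x * y) (evalP-scale c ds x)) (regroup c d x (evalP ds x))
  where regroup : ∀ c d x u → c * d + x * (c * u) ≡ c * (d + x * u)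
        regroup = solve-∀

evalP-mulP : ∀ P Q x → evalP (mulP P Q) x ≡ evalP P x * evalP Q x
evalP-mulP []       Q x = refl
evalP-mulP (c ∷ cs) Q x = begin
  evalP (addP (scale c Q) (0ℤ ∷ mulP cs Q)) x              ≡⟨ evalP-addP (scale c Q) (0ℤ ∷ mulP cs Q) x ⟩
  evalP (scale c Q) x + (0ℤ + x * evalP (mulP cs Q) x)     ≡⟨ cong₂ (λ u v → u + (0ℤ + x * v)) (evalP-scale c Q x) (evalP-mulP cs Q x) ⟩
  c * evalP Q x + (0ℤ + x * (evalP cs x * evalP Q x))      ≡⟨ regroup c x (evalP cs x) (evalP Q x) ⟩
  (c + x * evalP cs x) * evalP Q x                         ∎
  where
  open ≡-Reasoning
  regroup : ∀ c x u q → c * q + (0ℤ + x * (u * q)) ≡ (c + x * u) * q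
  regroup = solve-∀

evalP-cong : ∀ {P Q} x → P ≋ Q → evalP P x ≡ evalP Q x
evalP-cong {[]}     {[]}     x _       = refl
evalP-cong {[]}     {d ∷ ds} x (mk≋ e) =
  sym (trans (cong₂ (λ u v → u + x * v) (sym (e 0)) (sym (evalP-cong {[]} {ds} x (mk≋ (e ∘ suc))))) (cong (_+_ 0ℤ) (*-zeroʳ x)))
evalP-cong {c ∷ cs} {[]}     x (mk≋ e) =
  trans (cong₂ (λ u v → u + x * v) (e 0) (evalP-cong {cs} {[]} x (mk≋ (e ∘ suc)))) (cong (_+_ 0ℤ) (*-zeroʳ x))
evalP-cong {c ∷ cs} {d ∷ ds} x (mk≋ e) = cong₂ (λ u v → u + x * v) (e 0) (evalP-cong {cs} {ds} x (mk≋ (e ∘ suc)))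

linearFactor : ℤ → Poly
linearFactor γ = - γ ∷ 1ℤ ∷ []

divideByLinear : ℤ → Poly → Poly
divideByLinear γ []       = []
divideByLinear γ (c ∷ cs) = evalP cs γ ∷ divideByLinear γ cs

divideByLinear-spec : ∀ γ P → P ≋ addP [ evalP P γ ] (mulP (divideByLinear γ P) (linearFactor γ))
divideByLinear-spec γ []       = mk≋ λ { zero → refl ; (suc k) → refl }
divideByLinear-spec γ (c ∷ cs) = mk≋ λ
  { zero    → remainder c γ (evalP cs γ)
  ; (suc k) → coeff-≡ (≋-trans (divideByLinear-spec γ cs) (addP-cong [v]≋[v*1] (≋-refl {mulP (divideByLinear γ cs) (linearFactor γ)}))) k }
  where
  remainder : ∀ c γ v → c ≡ c + γ * v + (v * - γ + 0ℤ)
  remainder = solve-∀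
  [v]≋[v*1] : [ evalP cs γ ] ≋ [ evalP cs γ * 1ℤ ]
  [v]≋[v*1] = mk≋ λ { zero → sym (*-identityʳ _) ; (suc k) → refl }

divideByLinear-degree : ∀ γ {n} (W : Vecℤ (suc n)) → DegreeBelow (divideByLinear γ (toPoly W)) n
divideByLinear-degree γ {zero}  W = λ { zero _ → refl ; (suc k) _ → refl }
divideByLinear-degree γ {suc n} W = degreeBelow-∷ _ (divideByLinear-degree γ (W ∘ fsuc))

coeff-X^-linearFactor : ∀ γ i t → coeff (mulP (X^ i) (linearFactor γ)) t ≡ (- γ) * δ t i + δ t (suc i)
coeff-X^-linearFactor γ zero t = trans (coeff-≡ (mulP-identityˡ (linearFactor γ)) t) (at t)
  where
  at : ∀ t → coeff (linearFactor γ) t ≡ (- γ) * δ t 0 + δ t 1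
  at zero          = sym (trans (cong₂ (λ u v → (- γ) * u + v) (δ-refl 0) (δ-≢ {0} {1} (λ ()))) (trans (+-identityʳ _) (*-identityʳ (- γ))))
  at (suc zero)    = sym (trans (cong₂ (λ u v → (- γ) * u + v) (δ-≢ {1} {0} (λ ())) (δ-refl 1)) (cong (_+ 1ℤ) (*-zeroʳ (- γ))))
  at (suc (suc t)) = sym (trans (cong₂ (λ u v → (- γ) * u + v) (δ-≢ {2 ℕ.+ t} {0} (λ ())) (δ-≢ {2 ℕ.+ t} {1} (λ ())))
                                (trans (+-identityʳ _) (*-zeroʳ (- γ))))
coeff-X^-linearFactor γ (suc i) t = trans (coeff-≡ (mulP-shiftˡ (X^ i) (linearFactor γ)) t) (at t)
  where
  at : ∀ t → coeff (0ℤ ∷ mulP (X^ i) (linearFactor γ)) t ≡ (- γ) * δ t (suc i) + δ t (suc (suc i))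
  at zero    = sym (trans (cong₂ (λ u v → (- γ) * u + v) (δ-≢ {0} {suc i} (λ ())) (δ-≢ {0} {suc (suc i)} (λ ())))
                          (trans (+-identityʳ _) (*-zeroʳ (- γ))))
  at (suc t) = trans (coeff-X^-linearFactor γ i t) (sym (cong₂ (λ u v → (- γ) * u + v) (δ-suc t i) (δ-suc t (suc i))))

mod-[]⇒≋ : ∀ {P Q} → P ≋ Q mod [] → P ≋ Q
mod-[]⇒≋ {Q = Q} (modulo R P≋Q+0) = ≋-trans P≋Q+0 (addP-identityʳ Q)

module _ (p : ℕ) (γ : ℤ) {m : ℕ} where

  private
    A = genA {suc m} p γ

  toPoly-genA-zero : toPoly (A fzero) ≋ [ + p ]
  toPoly-genA-zero = toPoly-unique (A fzero) [ + p ] entry (degreeBelow-weaken {[ + p ]} (s≤s z≤n) (degreeBelow-length [ + p ]))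
    where
    entry : ∀ j → + p * δ (toℕ j) 0 ≡ coeff [ + p ] (toℕ j)
    entry fzero    = trans (cong (+ p *_) (δ-refl 0)) (*-identityʳ (+ p))
    entry (fsuc j) = trans (cong (+ p *_) (δ-≢ {suc (toℕ j)} {0} (λ ()))) (*-zeroʳ (+ p))

  toPoly-genA-suc : ∀ i → toPoly (A (fsuc i)) ≋ mulP (X^ toℕ i) (linearFactor γ)
  toPoly-genA-suc i = toPoly-unique (A (fsuc i)) _ (λ j → sym (coeff-X^-linearFactor γ (toℕ i) (toℕ j)))
    (degreeBelow-weaken {mulP (X^ toℕ i) (linearFactor γ)} i+2≤m+1 (degreeBelow-mulP (X^ toℕ i) (linearFactor γ) (toℕ i) 1 (degreeBelow-X^ (toℕ i)) (degreeBelow-length (linearFactor γ))))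
    where
    i+2≤m+1 : suc (toℕ i ℕ.+ 1) ≤ suc m
    i+2≤m+1 = s≤s (subst (_≤ m) (ℕₚ.+-comm 1 (toℕ i)) (Finₚ.toℕ<n i))

  toPoly-genA-lincomb : ∀ c → toPoly (λ j → sumF (λ i → c i * A i j)) ≋
                              addP (scale (c fzero) [ + p ]) (mulP (toPoly (c ∘ fsuc)) (linearFactor γ))
  toPoly-genA-lincomb c = ≋-trans (toPoly-+ (λ j → c fzero * A fzero j) (λ j → sumF (λ i → c (fsuc i) * A (fsuc i) j)))
    (addP-cong (≋-trans (toPoly-scale (c fzero) (A fzero)) (scale-cong (c fzero) toPoly-genA-zero))
               (mod-[]⇒≋ (toPoly-lincomb (A ∘ fsuc) (λ i → ≋⇒≋mod (toPoly-genA-suc i)) (c ∘ fsuc))))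

  inSpan-genA⇒∣ : ∀ W → InSpan A W → + p ∣ₛ evalP (toPoly W) γ
  inSpan-genA⇒∣ W (c , W≡∑) = divides (c fzero) (begin
    evalP (toPoly W) γ
      ≡⟨ evalP-cong γ (≋-trans (toPoly-cong W≡∑) (toPoly-genA-lincomb c)) ⟩
    evalP (addP (scale (c fzero) [ + p ]) (mulP (toPoly (c ∘ fsuc)) (linearFactor γ))) γ
      ≡⟨ evalP-addP (scale (c fzero) [ + p ]) (mulP (toPoly (c ∘ fsuc)) (linearFactor γ)) γ ⟩
    evalP (scale (c fzero) [ + p ]) γ + evalP (mulP (toPoly (c ∘ fsuc)) (linearFactor γ)) γ
      ≡⟨ cong₂ _+_ (evalP-scale (c fzero) [ + p ] γ) (evalP-mulP (toPoly (c ∘ fsuc)) (linearFactor γ) γ) ⟩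
    c fzero * evalP [ + p ] γ + evalP (toPoly (c ∘ fsuc)) γ * evalP (linearFactor γ) γ
      ≡⟨ γ-root (c fzero) (+ p) γ (evalP (toPoly (c ∘ fsuc)) γ) ⟩
    c fzero * + p ∎)
    where
    open ≡-Reasoning
    γ-root : ∀ c₀ p γ u → c₀ * (p + γ * 0ℤ) + u * (- γ + γ * (1ℤ + γ * 0ℤ)) ≡ c₀ * p
    γ-root = solve-∀

  ∣⇒inSpan-genA : ∀ W → + p ∣ₛ evalP (toPoly W) γ → InSpan A W
  ∣⇒inSpan-genA W (divides k W[γ]≡kp) = c , λ j → begin
    W j                                            ≡⟨ coeff-toPoly W j ⟨
    coeff (toPoly W) (toℕ j)                       ≡⟨ coeff-≡ W≋∑ (toℕ j) ⟩
    coeff (toPoly (λ j → sumF (λ i → c i * A i j))) (toℕ j) ≡⟨ coeff-toPoly (λ j → sumF (λ i → c i * A i j)) j ⟩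
    sumF (λ i → c i * A i j)                       ∎
    where
    open ≡-Reasoning
    Q = divideByLinear γ (toPoly W)
    c : Fin (suc m) → ℤ
    c fzero    = k
    c (fsuc i) = coeff Q (toℕ i)
    W≋∑ : toPoly W ≋ toPoly (λ j → sumF (λ i → c i * A i j))
    W≋∑ = ≋-trans (divideByLinear-spec γ (toPoly W))
      (≋-trans (addP-cong (≡⇒≋ (cong [_] W[γ]≡kp)) (mulP-cong (≋-sym (toPoly-unique (c ∘ fsuc) Q (λ _ → refl) (divideByLinear-degree γ W))) (≋-refl {linearFactor γ})))
               (≋-sym (toPoly-genA-lincomb c)))

inSpan-orbit : ∀ {n} (M : Fin n → Fin n → ℤ) V → InSpan (λ (i : Fin n) → vecMatPow V M (toℕ i)) V
inSpan-orbit {zero}  M V = (λ ()) , λ ()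
inSpan-orbit {suc n} M V = (λ i → δ (toℕ i) 0) , λ j → sym (begin
  δ 0 0 * V j + sumF (λ (i : Fin n) → δ (suc (toℕ i)) 0 * vecMatPow V M (suc (toℕ i)) j)
    ≡⟨ cong₂ _+_ (trans (cong (_* V j) (δ-refl 0)) (*-identityˡ (V j)))
                 (sumF-zero {n} λ i → trans (cong (_* vecMatPow V M (suc (toℕ i)) j) (δ-≢ {suc (toℕ i)} {0} (λ ()))) (*-zeroˡ (vecMatPow V M (suc (toℕ i)) j))) ⟩
  V j + 0ℤ
    ≡⟨ +-identityʳ (V j) ⟩
  V j ∎)
  where open ≡-Reasoning

module _ (n : ℕ) (a : Fin n → ℤ) (V : Vecℤ n) where

  private
    E = monicPoly n a
    B = λ (i : Fin n) → vecMatPow V (companion n a) (toℕ i)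

  toPoly-orbit-lincomb : ∀ c → toPoly (λ j → sumF (λ i → c i * B i j)) ≋ mulP (toPoly c) (toPoly V) mod E
  toPoly-orbit-lincomb = toPoly-lincomb B (λ i → toPoly-power-mod n a V (toℕ i))

  orbit-linearIndependent : IrreducibleP E → ¬ IsZeroVec V → LinIndep B
  orbit-linearIndependent (_ , _ , E-irreducible) V≢0 c ∑≡0 i with ≋[]? (toPoly c)
  ... | yes c≋0 = trans (sym (coeff-toPoly c i)) (coeff-≡ c≋0 (toℕ i))
  ... | no c≢0  = ⊥-elim (¬monic∣mulP E (monicPoly-monic n a) (monicPoly-degree n a) E-irreducible
                           (toPoly V) (toPoly-degree V) V≢0ₚ n ℕₚ.≤-refl (toPoly-degree c) c≢0 R cV≋ER)
    where
    open _≋_mod_ (mod-sym (toPoly-orbit-lincomb c)) renaming (multiplier to R; congruence to cV≋∑+ER)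
    V≢0ₚ : ¬ toPoly V ≋ []
    V≢0ₚ V≋0 = V≢0 λ j → trans (sym (coeff-toPoly V j)) (coeff-≡ V≋0 (toℕ j))
    cV≋ER : mulP (toPoly c) (toPoly V) ≋ mulP E R
    cV≋ER = ≋-trans cV≋∑+ER (addP-cong (toPoly-zero ∑≡0) ≋-refl)

orbit-sublattice : ∀ {m} p γ (a : Fin (suc m) → ℤ) (V : Vecℤ (suc m)) →
  + p ∣ₛ evalP (monicPoly (suc m) a) γ → InSpan (genA p γ) V →
  ∀ w → InSpan (λ (i : Fin (suc m)) → vecMatPow V (companion (suc m) a) (toℕ i)) w → InSpan (genA p γ) w
orbit-sublattice {m} p γ a V p∣E[γ] V∈𝔏 w (c , w≡∑) = ∣⇒inSpan-genA p γ w p∣w[γ]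
  where
  open ≡-Reasoning
  open _≋_mod_ (toPoly-orbit-lincomb (suc m) a V c) renaming (multiplier to R; congruence to ∑≋cV+ER)
  E = monicPoly (suc m) a
  w[γ]≡ : evalP (toPoly w) γ ≡ evalP (toPoly c) γ * evalP (toPoly V) γ + evalP E γ * evalP R γ
  w[γ]≡ = begin
    evalP (toPoly w) γ                                           ≡⟨ evalP-cong γ (≋-trans (toPoly-cong w≡∑) ∑≋cV+ER) ⟩
    evalP (addP (mulP (toPoly c) (toPoly V)) (mulP E R)) γ       ≡⟨ evalP-addP (mulP (toPoly c) (toPoly V)) (mulP E R) γ ⟩
    evalP (mulP (toPoly c) (toPoly V)) γ + evalP (mulP E R) γ    ≡⟨ cong₂ _+_ (evalP-mulP (toPoly c) (toPoly V) γ) (evalP-mulP E R γ) ⟩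
    evalP (toPoly c) γ * evalP (toPoly V) γ + evalP E γ * evalP R γ ∎
  p∣w[γ] : + p ∣ₛ evalP (toPoly w) γ
  p∣w[γ] = subst (+ p ∣ₛ_) (sym w[γ]≡)
    (∣m∣n⇒∣m+n (∣n⇒∣m*n (evalP (toPoly c) γ) (inSpan-genA⇒∣ p γ V V∈𝔏)) (∣m⇒∣m*n (evalP R γ) p∣E[γ]))

corollary1 : (p n : ℕ) → 2 ≤ p → 2 ≤ n
  → (a : Fin n → ℤ) → IrreducibleP (monicPoly n a)
  → (γ : ℤ) → (+ p) ∣ evalP (monicPoly n a) γ
  → (V : Vecℤ n) → InSpan (genA p γ) V → ¬ IsZeroVec V
  → let B = λ (i : Fin n) → vecMatPow V (companion n a) (toℕ i)
    in LinIndep B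
       × (∀ w → InSpan B w → InSpan (genA p γ) w)
       × InSpan B V
corollary1 p zero    _ ()
corollary1 p (suc m) _ _ a E-irreducible γ p∣E[γ] V V∈𝔏 V≢0 =
    orbit-linearIndependent (suc m) a V E-irreducible V≢0
  , orbit-sublattice p γ a V (∣ᵤ⇒∣ p∣E[γ]) V∈𝔏
  , inSpan-orbit (companion (suc m) a) V
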